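{- If the XOR-clause-set $F$ is acyclic, then $X_1(F)$ is an absolute forcing representation of $F$.
   Context: Clauses are finite sets of literals without complementary pairs ($\bot$ empty clause), clause-sets finite sets of clauses read as CNF ($\top$ empty clause-set); $\varphi*F$ applies a partial assignment. A literal $x$ is forced for $F$ if $\langle x\to0\rangle*F$ is unsatisfiable. $r_1$ is unit-clause propagation. For a variable set $V$, $\mathrm{phd}^V(F)\le 1$ means: for every partial $\varphi$ with $\mathrm{var}(\varphi)\subseteq V$, if $\varphi*F$ is unsatisfiable then $r_1(\varphi*F)=\{\bot\}$, and otherwise $r_1(\varphi*F)$ has no forced literal with variable in $V$; $F\in\mathcal{PC}$ means $\mathrm{phd}^{\mathrm{var}(F)}(F)\le1$. An XOR-clause $C$ denotes $\bigoplus_{x\in C}x=0$ over $\mathbb{Z}_2$; an XOR-clause-set is a conjunction of such. $F$ is acyclic if the bipartite graph with parts $\mathrm{var}(F)$ and $F$, with $v$ adjacent to $C$ iff $v\in\mathrm{var}(C)$, has no cycle. $X_0(C)$: all clauses $D$ with $\mathrm{var}(D)=\mathrm{var}(C)$ whose number of complemented literals has parity different from that in $C$. Natural splitting of $C=\{x_1,\dots,x_n\}$ (in some order): $\{C\}$ if $n\le2$, else the XOR-clauses $\{x_1,x_2,y_2\}$, $\{y_{i-1},x_i,y_i\}$ ($3\le i\le n-1$), $\{y_{n-1},x_n\}$ with new variables $y_j$; $X_1(C)=\bigcup X_0$ of these; $X_1(F)=\bigcup_{C\in F}X_1(C)$ with new variables for distinct clauses pairwise disjoint. A CNF-representation of $F$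 is a clause-set $F'$ with $\mathrm{var}(F)\subseteq\mathrm{var}(F')$ such that for every total assignment $\varphi$ of $\mathrm{var}(F)$, $\varphi*F'$ is satisfiable iff $\varphi$ satisfies $F$. It is forcing if $\mathrm{phd}^{\mathrm{var}(F)}(F')\le1$ and $r_1(\varphi*F')=\top$ for every total $\varphi$ of $\mathrm{var}(F)$ with $\varphi*F'$ satisfiable; absolute forcing if additionally $F'\in\mathcal{PC}$. -}

module Defs where

open import Data.Nat using (ℕ; zero; suc; _+_; _≟_)
open import Data.Nat.DivMod using (_mod_)
open import Data.Bool using (Bool; true; false; not; _xor_; if_then_else_; _∨_)
open import Data.Maybe using (Maybe; just; nothing; fromMaybe)
open import Data.List using (List; []; _∷_; [_]; _++_; map; concatMap; mapMaybe; filterᵇ; length; lookup; foldr)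
open import Data.Nat.ListAction using (sum)
open import Data.Bool.ListAction using (any)
open import Data.List.Membership.Propositional using (_∈_; _∉_)
open import Data.List.Relation.Unary.All using (All)
open import Data.List.Relation.Unary.Any using (Any)
open import Data.List.Relation.Unary.AllPairs using (AllPairs)
open import Data.List.Relation.Unary.Unique.Propositional using (Unique)
open import Data.Fin using (Fin; toℕ)
open import Data.Product using (Σ; ∃; _×_; _,_)
open import Function.Definitions using (Injective)
open import Relation.Binary.PropositionalEquality using (_≡_; _≢_)
open import Relation.Nullary using (¬_; does)

data Lit : Set where
  pos : ℕ → Lit
  neg : ℕ → Lit

var : Lit → ℕ
var (pos v) = v
var (neg v) = v

isNeg : Lit → Bool
isNeg (pos _) = false
isNeg (neg _) = true

-- a clause is represented by a list of literals (read as a set);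
-- a clause-set by a list of clauses (read as a set)
Clause : Set
Clause = List Lit

ClauseSet : Set
ClauseSet = List Clause

varsC : Clause → List ℕ
varsC C = map var C

vars : ClauseSet → List ℕ
vars F = concatMap varsC F

-- proper clause: no repeated variable (so no duplicate and no complementary literals)
ProperClause : Clause → Set
ProperClause C = Unique (varsC C)

SameClause : Clause → Clause → Set
SameClause C D = (∀ x → x ∈ C → x ∈ D) × (∀ x → x ∈ D → x ∈ C)

-- a list of clauses faithfully representing a finite set of (proper) clauses
WellFormed : ClauseSet → Set
WellFormed F = All ProperClause F × AllPairs (λ C D → ¬ SameClause C D) F

TAss : Set
TAss = ℕ → Bool

litVal : TAss → Lit → Bool
litVal β (pos v) = β v
litVal β (neg v) = not (β v)

PAss : Set
PAss = ℕ → Maybe Bool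

DomIn : PAss → List ℕ → Set
DomIn φ V = ∀ v b → φ v ≡ just b → v ∈ V

TotalOn : PAss → List ℕ → Set
TotalOn φ V = (∀ v → v ∈ V → ∃ λ b → φ v ≡ just b) × DomIn φ V

plitVal : PAss → Lit → Maybe Bool
plitVal φ (pos v) = φ v
plitVal φ (neg v) with φ v
... | just b = just (not b)
... | nothing = nothing

isTrue : Maybe Bool → Bool
isTrue (just true) = true
isTrue _ = false

isUnassigned : Maybe Bool → Bool
isUnassigned nothing = true
isUnassigned (just _) = false

applyC : PAss → Clause → Maybe Clause
applyC φ C = if any (λ l → isTrue (plitVal φ l)) C
             then nothing
             else just (filterᵇ (λ l → isUnassigned (plitVal φ l)) C)

apply : PAss → ClauseSet → ClauseSet
apply φ F = mapMaybe (applyC φ) F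

-- the assignment ⟨x → b⟩ (literal x gets value b)
single : Lit → Bool → PAss
single x b v = if does (v ≟ var x) then just (if isNeg x then not b else b) else nothing

Sat : ClauseSet → Set
Sat F = ∃ λ (β : TAss) → All (λ C → Any (λ l → litVal β l ≡ true) C) F

Forced : Lit → ClauseSet → Set
Forced x F = ¬ Sat (apply (single x false) F)

isEmpty : Clause → Bool
isEmpty [] = true
isEmpty (_ ∷ _) = false

findUnit : ClauseSet → Maybe Lit
findUnit [] = nothing
findUnit ((x ∷ []) ∷ F) = just x
findUnit (_ ∷ F) = findUnit F

size : ClauseSet → ℕ
size F = sum (map length F)

-- each propagation step strictly decreases 'size', so fuel 'suc (size F)' suffices
r1-fuel : ℕ → ClauseSet → ClauseSet
r1-fuel zero F = F
r1-fuel (suc k) F with any isEmpty F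
... | true = [ [] ]
... | false with findUnit F
...   | nothing = F
...   | just x = r1-fuel k (apply (single x true) F)

r1 : ClauseSet → ClauseSet
r1 F = r1-fuel (suc (size F)) F

-- G = {⊥} as a set of clauses
IsBotSet : ClauseSet → Set
IsBotSet G = (G ≢ []) × All (λ C → C ≡ []) G

Phd≤1 : List ℕ → ClauseSet → Set
Phd≤1 V F = ∀ (φ : PAss) → DomIn φ V →
  (¬ Sat (apply φ F) → IsBotSet (r1 (apply φ F))) ×
  (Sat (apply φ F) → ∀ x → var x ∈ V → ¬ Forced x (r1 (apply φ F)))

PC : ClauseSet → Set
PC F = Phd≤1 (vars F) F

xorVal : TAss → Clause → Bool
xorVal β C = foldr (λ l acc → litVal β l xor acc) false C

XSat : TAss → ClauseSet → Set
XSat β F = All (λ C → xorVal β C ≡ false) F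

-- a total assignment of var(F) viewed as a total assignment (values off var(F) irrelevant)
toTAss : PAss → TAss
toTAss φ v = fromMaybe false (φ v)

next : ∀ {n} → Fin (suc n) → Fin (suc n)
next {n} i = suc (toℕ i) mod (suc n)

-- a cycle v₀ C₀ v₁ C₁ … v_{k+1} C_{k+1} v₀ (length ≥ 4), vertices pairwise distinct;
-- clauses are identified by their position in the (duplicate-free) list
record Cycle (F : ClauseSet) : Set where
  field
    k      : ℕ
    vs     : Fin (suc (suc k)) → ℕ
    cs     : Fin (suc (suc k)) → Fin (length F)
    vs-inj : Injective _≡_ _≡_ vs
    cs-inj : Injective _≡_ _≡_ cs
    edge₁  : ∀ i → vs i ∈ varsC (lookup F (cs i))
    edge₂  : ∀ i → vs (next i) ∈ varsC (lookup F (cs i))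

Acyclic : ClauseSet → Set
Acyclic F = ¬ Cycle F

negParity : Clause → Bool
negParity C = foldr (λ l acc → isNeg l xor acc) false C

allSigns : List ℕ → ClauseSet
allSigns [] = [ [] ]
allSigns (v ∷ vs) = map (pos v ∷_) (allSigns vs) ++ map (neg v ∷_) (allSigns vs)

X0 : Clause → ClauseSet
X0 C = filterᵇ (λ D → negParity D xor negParity C) (allSigns (varsC C))

-- tail of the natural splitting: current index i, previous new variable y_{i-1}
splitChain : (ℕ → ℕ) → ℕ → ℕ → List Lit → ClauseSet
splitChain y i prev [] = []
splitChain y i prev (x ∷ []) = (pos prev ∷ x ∷ []) ∷ []
splitChain y i prev (x ∷ x' ∷ rest) = (pos prev ∷ x ∷ pos (y i) ∷ []) ∷ splitChain y (suc i) (y i) (x' ∷ rest)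

-- natural splitting of C = (x₁,…,xₙ) in the list order, new variable y_j is 'y j'
naturalSplit : (ℕ → ℕ) → Clause → ClauseSet
naturalSplit y (x₁ ∷ x₂ ∷ x₃ ∷ rest) =
  (x₁ ∷ x₂ ∷ pos (y 2) ∷ []) ∷ splitChain y 3 (y 2) (x₃ ∷ rest)
naturalSplit y C = [ C ]

X1C : (ℕ → ℕ) → Clause → ClauseSet
X1C y C = concatMap X0 (naturalSplit y C)

-- X₁(F); the i-th clause of F uses the new variables y i j
X1-from : ℕ → (ℕ → ℕ → ℕ) → ClauseSet → ClauseSet
X1-from i y [] = []
X1-from i y (C ∷ F) = X1C (y i) C ++ X1-from (suc i) y F

X1 : (ℕ → ℕ → ℕ) → ClauseSet → ClauseSet
X1 y F = X1-from 0 y F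

Fresh : ClauseSet → (ℕ → ℕ → ℕ) → Set
Fresh F y = (∀ i j i' j' → y i j ≡ y i' j' → (i ≡ i') × (j ≡ j'))
          × (∀ i j → y i j ∉ vars F)

CNFRep : ClauseSet → ClauseSet → Set
CNFRep F F' = (∀ v → v ∈ vars F → v ∈ vars F')
            × (∀ φ → TotalOn φ (vars F) →
                 (Sat (apply φ F') → XSat (toTAss φ) F) × (XSat (toTAss φ) F → Sat (apply φ F')))

Forcing : ClauseSet → ClauseSet → Set
Forcing F F' = CNFRep F F' × Phd≤1 (vars F) F'
             × (∀ φ → TotalOn φ (vars F) → Sat (apply φ F') → r1 (apply φ F') ≡ [])

AbsForcing : ClauseSet → ClauseSet → Set
AbsForcing F F' = Forcing F F' × PC F'

module Submission where

-- X₁(F) is the union of X₀(D) over the pieces D of the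
-- natural splittings, and X₀(D) is the CNF of the XOR constraint D.
--
-- Key fact (`solve-fixpoint`): if ρ * X₁(F) has no empty and no unit clause,
-- every piece keeps two open variables or is already satisfied, so it can be
-- solved with any prescribed value on any variable; the pieces of a clause form
-- a chain, and acyclicity lists the clauses so that each meets the later ones in
-- at most one variable, so these local solutions glue (`forest-solvable`).
-- Since r₁ refutes or stops at such a ρ, phd ≤ 1 and PC follow; the
-- representation property comes from the semantics of X₀ and of the splitting,
-- and r₁ reaching ⊤ on total assignments from the new variables being
-- determined by the old ones.

open import Defs
open import Data.Nat using (ℕ; zero; suc; _+_; _∸_; _≤_; _<_; z≤n; s≤s)
import Data.Nat as ℕ
open import Data.Nat.Properties
  using (≤-refl; ≤-trans; ≤-pred; n≤1+n; n<1+n; <-irrefl; <-cmp; m≤m+n; m≤n+m;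
         +-suc; +-identityʳ; +-mono-≤; +-mono-≤-<; +-monoʳ-<; +-monoʳ-≤; <-≤-trans;
         m≤n⇒m<n∨m≡n; m+[n∸m]≡n; ≤-reflexive)
open import Data.Nat.DivMod using (_%_; m<n⇒m%n≡m; n%n≡0)
open import Data.Fin using (Fin; toℕ) renaming (zero to fzero; suc to fsuc)
import Data.Fin.Properties as Fin
open import Data.Bool using (Bool; true; false; not; _xor_; if_then_else_; _∨_)
open import Data.Bool.ListAction using (any)
open import Data.Bool.Properties
  using (xor-assoc; xor-comm; xor-same; xor-identityʳ; xor-inverseˡ; xor-inverseʳ; not-involutive; T-≡; xor-∧-commutativeRing)
open import Algebra.Bundles using (CommutativeRing)
open import Algebra.Properties.CommutativeSemigroup
  (CommutativeRing.+-commutativeSemigroup xor-∧-commutativeRing) using (interchange)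
open import Data.Maybe using (Maybe; just; nothing; maybe′; fromMaybe; _<∣>_)
open import Data.List
  using (List; []; _∷_; [_]; _++_; map; mapMaybe; filter; filterᵇ; length; concat; lookup; allFin; upTo)
open import Data.List.Properties using (length-filter; filter-notAll; length-tabulate; ++-identityʳ; ∷-injectiveˡ; ∷-injectiveʳ)
open import Data.List.Membership.Propositional using (_∈_; _∉_; find; lose)
open import Data.List.Membership.Propositional.Properties
  using (∈-++⁺ˡ; ∈-++⁺ʳ; ∈-++⁻; ∈-map⁺; ∈-map⁻; ∈-concatMap⁺; ∈-concatMap⁻; ∈-filter⁺; ∈-filter⁻;
         ∈-lookup; ∈-concat⁺′; ∈-concat⁻′; ∈-allFin; ∈-applyUpTo⁺; ∈-applyUpTo⁻)
open import Data.List.Membership.DecPropositional ℕ._≟_ using (_∈?_)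
open import Data.List.Relation.Unary.All as All using (All; []; _∷_)
open import Data.List.Relation.Unary.All.Properties using (++⁺; All¬⇒¬Any)
open import Data.List.Relation.Unary.Any as Any using (Any; here; there)
open import Data.List.Relation.Unary.Any.Properties using (lookup-index)
open import Data.List.Relation.Unary.AllPairs using ([]; _∷_)
open import Data.List.Relation.Unary.Unique.Propositional using (Unique)
open import Data.Product using (Σ; ∃; ∃₂; _×_; _,_; proj₁; proj₂)
open import Data.Sum using (_⊎_; inj₁; inj₂)
open import Data.Empty using (⊥; ⊥-elim)
open import Function using (_∘_)
open import Function.Bundles using (Equivalence)
open import Relation.Binary.PropositionalEquality
  using (_≡_; _≢_; refl; sym; trans; cong; cong₂; subst; module ≡-Reasoning)
open import Relation.Binary.Definitions using (tri<; tri≈; tri>)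
open import Relation.Nullary using (¬_; Dec; yes; no; does; ¬?; _×-dec_)
open import Relation.Nullary.Decidable using (T?)

private
  variable
    A B : Set

if-yes : ∀ {P : Set} (d : Dec P) {x y : A} → P → (if does d then x else y) ≡ x
if-yes (yes _) _ = refl
if-yes (no ¬p) p = ⊥-elim (¬p p)

if-no : ∀ {P : Set} (d : Dec P) {x y : A} → ¬ P → (if does d then x else y) ≡ y
if-no (yes p) ¬p = ⊥-elim (¬p p)
if-no (no _) _ = refl

filterᵇ-cons : (p : A → Bool) (x : A) (xs : List A) →
  filterᵇ p (x ∷ xs) ≡ (if p x then x ∷ filterᵇ p xs else filterᵇ p xs)
filterᵇ-cons p x xs with p x
... | true = refl
... | false = refl

filterᵇ-∈⁺ : (p : A → Bool) {x : A} (xs : List A) → x ∈ xs → p x ≡ true → x ∈ filterᵇ p xs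
filterᵇ-∈⁺ p xs x∈ px = ∈-filter⁺ (T? ∘ p) x∈ (Equivalence.from T-≡ px)

filterᵇ-∈⁻ : (p : A → Bool) {x : A} (xs : List A) → x ∈ filterᵇ p xs → (x ∈ xs) × (p x ≡ true)
filterᵇ-∈⁻ p xs x∈ with ∈-filter⁻ (T? ∘ p) {xs = xs} x∈
... | x∈xs , px = x∈xs , Equivalence.to T-≡ px

length-filterᵇ : (p : A → Bool) (xs : List A) → length (filterᵇ p xs) ≤ length xs
length-filterᵇ p = length-filter (T? ∘ p)

mapMaybe-∈⁻ : (f : A → Maybe B) {x : B} (xs : List A) → x ∈ mapMaybe f xs → ∃ λ y → (y ∈ xs) × (f y ≡ just x)
mapMaybe-∈⁻ f (y ∷ ys) x∈ with f y in fy
mapMaybe-∈⁻ f (y ∷ ys) (here refl) | just _ = y , here refl , fy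
mapMaybe-∈⁻ f (y ∷ ys) (there x∈) | just _ = let z , z∈ , fz = mapMaybe-∈⁻ f ys x∈ in z , there z∈ , fz
mapMaybe-∈⁻ f (y ∷ ys) x∈ | nothing = let z , z∈ , fz = mapMaybe-∈⁻ f ys x∈ in z , there z∈ , fz

mapMaybe-∈⁺ : (f : A → Maybe B) {x : B} {y : A} (xs : List A) → y ∈ xs → f y ≡ just x → x ∈ mapMaybe f xs
mapMaybe-∈⁺ f (y ∷ ys) (here refl) fy rewrite fy = here refl
mapMaybe-∈⁺ f (y ∷ ys) (there y∈) fy with f y
... | just _ = there (mapMaybe-∈⁺ f ys y∈ fy)
... | nothing = mapMaybe-∈⁺ f ys y∈ fy

any-false : (p : A → Bool) (xs : List A) → any p xs ≡ false → ∀ x → x ∈ xs → p x ≡ false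
any-false p (y ∷ ys) none x x∈ with p y in py | x∈
... | false | here refl = py
... | false | there x∈ys = any-false p ys none x x∈ys

any-true : (p : A → Bool) (xs : List A) → any p xs ≡ true → ∃ λ x → (x ∈ xs) × (p x ≡ true)
any-true p (y ∷ ys) some with p y in py
... | true = y , here refl , py
... | false = let x , x∈ , px = any-true p ys some in x , there x∈ , px

any-intro : (p : A → Bool) (xs : List A) {x : A} → x ∈ xs → p x ≡ true → any p xs ≡ true
any-intro p (y ∷ ys) (here refl) px rewrite px = refl
any-intro p (y ∷ ys) (there x∈) px with p y
... | true = refl
... | false = any-intro p ys x∈ px

complete : PAss → TAss → TAss
complete ρ β v = fromMaybe (β v) (ρ v)

_▷_ : PAss → PAss → PAss
(ρ ▷ σ) v = ρ v <∣> σ v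

_⊑_ : PAss → PAss → Set
ρ ⊑ ρ' = ∀ v b → ρ v ≡ just b → ρ' v ≡ just b

⊑-▷ : ∀ ρ σ → ρ ⊑ (ρ ▷ σ)
⊑-▷ ρ σ v b ρv rewrite ρv = refl

⊑-trans : ∀ {ρ ρ' ρ''} → ρ ⊑ ρ' → ρ' ⊑ ρ'' → ρ ⊑ ρ''
⊑-trans p q v b ρv = q v b (p v b ρv)

complete-⊑ : ∀ φ ρ' γ → φ ⊑ ρ' → ∀ v → complete φ (complete ρ' γ) v ≡ complete ρ' γ v
complete-⊑ φ ρ' γ ext v with φ v in φv
... | nothing = refl
... | just b rewrite ext v b φv = refl

SatBy : TAss → ClauseSet → Set
SatBy β G = All (λ C → Any (λ l → litVal β l ≡ true) C) G

unassigned : PAss → Lit → Bool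
unassigned ρ l = isUnassigned (plitVal ρ l)

true-under : PAss → Lit → Bool
true-under ρ l = isTrue (plitVal ρ l)

litVal-cong : ∀ γ γ' l → γ (var l) ≡ γ' (var l) → litVal γ l ≡ litVal γ' l
litVal-cong γ γ' (pos v) eq = eq
litVal-cong γ γ' (neg v) eq = cong not eq

litVal-xor : ∀ γ l → litVal γ l ≡ γ (var l) xor isNeg l
litVal-xor γ (pos v) with γ v
... | true = refl
... | false = refl
litVal-xor γ (neg v) with γ v
... | true = refl
... | false = refl

litVal-false : ∀ β x → β (var x) ≡ isNeg x → litVal β x ≡ false
litVal-false β x βx = trans (litVal-xor β x) (trans (cong (_xor isNeg x) βx) (xor-same (isNeg x)))

plitVal-just : ∀ ρ β l b → plitVal ρ l ≡ just b → litVal (complete ρ β) l ≡ b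
plitVal-just ρ β (pos v) b ρl rewrite ρl = refl
plitVal-just ρ β (neg v) b ρl with ρ v
plitVal-just ρ β (neg v) b refl | just c = refl

plitVal-nothing : ∀ ρ β l → plitVal ρ l ≡ nothing → litVal (complete ρ β) l ≡ litVal β l
plitVal-nothing ρ β (pos v) ρl rewrite ρl = refl
plitVal-nothing ρ β (neg v) ρl with ρ v
plitVal-nothing ρ β (neg v) () | just c
plitVal-nothing ρ β (neg v) ρl | nothing = refl

plitVal-nothing-var : ∀ ρ l → plitVal ρ l ≡ nothing → ρ (var l) ≡ nothing
plitVal-nothing-var ρ (pos v) ρl = ρl
plitVal-nothing-var ρ (neg v) ρl with ρ v
plitVal-nothing-var ρ (neg v) () | just _
... | nothing = refl

unassigned-var : ∀ ρ l → unassigned ρ l ≡ isUnassigned (ρ (var l))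
unassigned-var ρ (pos v) = refl
unassigned-var ρ (neg v) with ρ v
... | just _ = refl
... | nothing = refl

plitVal-▷ : ∀ ρ σ l → plitVal (ρ ▷ σ) l ≡ plitVal ρ l <∣> plitVal σ l
plitVal-▷ ρ σ (pos v) = refl
plitVal-▷ ρ σ (neg v) with ρ v
... | just b = refl
... | nothing = refl

isTrue-just : ∀ m → isTrue m ≡ true → m ≡ just true
isTrue-just (just true) _ = refl

isUnassigned-nothing : ∀ (m : Maybe Bool) → isUnassigned m ≡ true → m ≡ nothing
isUnassigned-nothing nothing _ = refl

data Applied (ρ : PAss) (C : Clause) : Set where
  satisfied : applyC ρ C ≡ nothing → ∃ (λ l → (l ∈ C) × (plitVal ρ l ≡ just true)) → Applied ρ C
  reduced   : applyC ρ C ≡ just (filterᵇ (unassigned ρ) C) →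
              (∀ l → l ∈ C → true-under ρ l ≡ false) → Applied ρ C

applied : ∀ ρ C → Applied ρ C
applied ρ C with any (true-under ρ) C in some
... | true = satisfied (cong (λ b → if b then nothing else just (filterᵇ (unassigned ρ) C)) some)
                       (let l , l∈ , lt = any-true _ C some in l , l∈ , isTrue-just _ lt)
... | false = reduced (cong (λ b → if b then nothing else just (filterᵇ (unassigned ρ) C)) some)
                      (any-false _ C some)

apply-∷-just : ∀ ρ C F {D} → applyC ρ C ≡ just D → apply ρ (C ∷ F) ≡ D ∷ apply ρ F
apply-∷-just ρ C F eq rewrite eq = refl

apply-∷-nothing : ∀ ρ C F → applyC ρ C ≡ nothing → apply ρ (C ∷ F) ≡ apply ρ F
apply-∷-nothing ρ C F eq rewrite eq = refl

sat-apply : ∀ ρ β γ F → (∀ v → complete ρ β v ≡ γ v) → SatBy γ F → SatBy β (apply ρ F)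
sat-apply ρ β γ [] agree [] = []
sat-apply ρ β γ (C ∷ F) agree (γC ∷ γF) with applied ρ C
... | satisfied eq _ rewrite eq = sat-apply ρ β γ F agree γF
... | reduced eq none rewrite eq = open-literal (find γC) ∷ sat-apply ρ β γ F agree γF
  where
  open-literal : ∃ (λ l → (l ∈ C) × (litVal γ l ≡ true)) →
                 Any (λ l → litVal β l ≡ true) (filterᵇ (unassigned ρ) C)
  open-literal (l , l∈ , γl) with plitVal ρ l in ρl
  ... | just true with trans (sym (cong isTrue ρl)) (none l l∈)
  ...   | ()
  open-literal (l , l∈ , γl) | just false
    with trans (sym (plitVal-just ρ β l false ρl)) (trans (litVal-cong _ γ l (agree (var l))) γl)
  ...   | ()
  open-literal (l , l∈ , γl) | nothing =
    lose (filterᵇ-∈⁺ _ C l∈ (cong isUnassigned ρl))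
         (trans (sym (plitVal-nothing ρ β l ρl)) (trans (litVal-cong _ γ l (agree (var l))) γl))

apply-sat : ∀ ρ β F → SatBy β (apply ρ F) → SatBy (complete ρ β) F
apply-sat ρ β [] _ = []
apply-sat ρ β (C ∷ F) βF with applied ρ C
... | satisfied eq (l , l∈ , ρl) rewrite eq = lose l∈ (plitVal-just ρ β l true ρl) ∷ apply-sat ρ β F βF
... | reduced eq _ with subst (SatBy β) (apply-∷-just ρ C F eq) βF
...   | βC ∷ βF' = original-literal (find βC) ∷ apply-sat ρ β F βF'
  where
  original-literal : ∃ (λ l → (l ∈ filterᵇ (unassigned ρ) C) × (litVal β l ≡ true)) →
                     Any (λ l → litVal (complete ρ β) l ≡ true) C
  original-literal (l , l∈ , βl) with filterᵇ-∈⁻ _ C l∈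
  ... | l∈C , open-l with plitVal ρ l in ρl
  ...   | nothing = lose l∈C (trans (plitVal-nothing ρ β l ρl) βl)
  original-literal (l , l∈ , βl) | l∈C , () | just _

module _ (ρ σ : PAss) where
  private
    any-▷ : ∀ C → (∀ l → l ∈ C → true-under ρ l ≡ false) →
      any (true-under (ρ ▷ σ)) C ≡ any (true-under σ) (filterᵇ (unassigned ρ) C)
    any-▷ [] _ = refl
    any-▷ (l ∷ C) none rewrite filterᵇ-cons (unassigned ρ) l C | plitVal-▷ ρ σ l with plitVal ρ l in ρl
    ... | nothing = cong (true-under σ l ∨_) (any-▷ C (λ l' l'∈ → none l' (there l'∈)))
    ... | just false = any-▷ C (λ l' l'∈ → none l' (there l'∈))
    ... | just true with trans (sym (cong isTrue ρl)) (none l (here refl))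
    ...   | ()

    filter-▷ : ∀ C → (∀ l → l ∈ C → true-under ρ l ≡ false) →
      filterᵇ (unassigned (ρ ▷ σ)) C ≡ filterᵇ (unassigned σ) (filterᵇ (unassigned ρ) C)
    filter-▷ [] _ = refl
    filter-▷ (l ∷ C) none
      rewrite filterᵇ-cons (unassigned (ρ ▷ σ)) l C | filterᵇ-cons (unassigned ρ) l C with plitVal ρ l in ρl
    ... | nothing rewrite filterᵇ-cons (unassigned σ) l (filterᵇ (unassigned ρ) C) | plitVal-▷ ρ σ l | ρl =
          cong (λ D → if unassigned σ l then l ∷ D else D) (filter-▷ C (λ l' l'∈ → none l' (there l'∈)))
    ... | just false rewrite plitVal-▷ ρ σ l | ρl = filter-▷ C (λ l' l'∈ → none l' (there l'∈))
    ... | just true with trans (sym (cong isTrue ρl)) (none l (here refl))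
    ...   | ()

  apply-▷ : ∀ F → apply σ (apply ρ F) ≡ apply (ρ ▷ σ) F
  apply-▷ [] = refl
  apply-▷ (C ∷ F) with applied ρ C
  ... | satisfied eq (l , l∈ , ρl) rewrite apply-∷-nothing ρ C F eq =
        trans (apply-▷ F) (sym (apply-∷-nothing (ρ ▷ σ) C F still-satisfied))
    where
    still-satisfied : applyC (ρ ▷ σ) C ≡ nothing
    still-satisfied = cong (λ b → if b then nothing else just (filterᵇ (unassigned (ρ ▷ σ)) C))
      (any-intro (true-under (ρ ▷ σ)) C l∈ (cong isTrue (trans (plitVal-▷ ρ σ l) (cong (_<∣> plitVal σ l) ρl))))
  ... | reduced eq none rewrite apply-∷-just ρ C F eq =
        trans (cong (λ m → maybe′ _∷_ (λ G → G) m (apply σ (apply ρ F))) (sym clause-▷))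
              (cong (maybe′ _∷_ (λ G → G) (applyC (ρ ▷ σ) C)) (apply-▷ F))
    where
    clause-▷ : applyC (ρ ▷ σ) C ≡ applyC σ (filterᵇ (unassigned ρ) C)
    clause-▷ = cong₂ (λ b D → if b then nothing else just D) (any-▷ C none) (filter-▷ C none)

single-var : ∀ x b → single x b (var x) ≡ just (if isNeg x then not b else b)
single-var x b = if-yes (var x ℕ.≟ var x) refl

single-other : ∀ x b v → v ≢ var x → single x b v ≡ nothing
single-other x b v v≢x = if-no (v ℕ.≟ var x) v≢x

plitVal-single : ∀ x b → plitVal (single x b) x ≡ just b
plitVal-single (pos v) b = single-var (pos v) b
plitVal-single (neg v) b rewrite single-var (neg v) b = cong just (not-involutive b)

complete-single : ∀ x b β → litVal β x ≡ b → ∀ v → complete (single x b) β v ≡ β v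
complete-single x b β βx v with v ℕ.≟ var x
... | no v≢x rewrite single-other x b v v≢x = refl
complete-single (pos v) b β βx v | yes refl rewrite single-var (pos v) b = sym βx
complete-single (neg v) b β βx v | yes refl rewrite single-var (neg v) b | sym βx = not-involutive (β v)

-- Unit-clause propagation

size-apply : ∀ σ G → size (apply σ G) ≤ size G
size-apply σ [] = z≤n
size-apply σ (C ∷ G) with applied σ C
... | satisfied eq _ rewrite apply-∷-nothing σ C G eq = ≤-trans (size-apply σ G) (m≤n+m _ (length C))
... | reduced eq _ rewrite apply-∷-just σ C G eq = +-mono-≤ (length-filterᵇ (unassigned σ) C) (size-apply σ G)

size-unit : ∀ G x → findUnit G ≡ just x → size (apply (single x true) G) < size G
size-unit ((y ∷ []) ∷ G) x refl with applied (single y true) (y ∷ [])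
... | satisfied eq _ rewrite apply-∷-nothing (single y true) (y ∷ []) G eq = s≤s (size-apply (single y true) G)
... | reduced eq none with trans (sym (cong isTrue (plitVal-single y true))) (none y (here refl))
...   | ()
size-unit ([] ∷ G) x found = size-unit G x found
size-unit ((a ∷ b ∷ c) ∷ G) x found with applied (single x true) (a ∷ b ∷ c)
... | satisfied eq _ rewrite apply-∷-nothing (single x true) (a ∷ b ∷ c) G eq =
       ≤-trans (size-unit G x found) (m≤n+m _ (length (a ∷ b ∷ c)))
... | reduced eq _ rewrite apply-∷-just (single x true) (a ∷ b ∷ c) G eq =
       +-mono-≤-< (length-filterᵇ (unassigned (single x true)) (a ∷ b ∷ c)) (size-unit G x found)

findUnit-just : ∀ G x → findUnit G ≡ just x → [ x ] ∈ G
findUnit-just ((y ∷ []) ∷ G) x refl = here refl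
findUnit-just ([] ∷ G) x found = there (findUnit-just G x found)
findUnit-just ((a ∷ b ∷ c) ∷ G) x found = there (findUnit-just G x found)

findUnit-nothing : ∀ G → findUnit G ≡ nothing → ∀ l → [ l ] ∉ G
findUnit-nothing ((y ∷ []) ∷ G) () l l∈
findUnit-nothing ([] ∷ G) none l (there l∈) = findUnit-nothing G none l l∈
findUnit-nothing ((a ∷ b ∷ c) ∷ G) none l (there l∈) = findUnit-nothing G none l l∈

isEmpty-[] : ∀ C → isEmpty C ≡ true → C ≡ []
isEmpty-[] [] _ = refl

empty-unsat : ∀ G → [] ∈ G → ¬ Sat G
empty-unsat G []∈ (β , βG) with All.lookup βG []∈
... | ()

unit-sat : ∀ G x → [ x ] ∈ G → Sat G → Sat (apply (single x true) G)
unit-sat G x x∈ (β , βG) = β , sat-apply (single x true) β β G (complete-single x true β βx) βG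
  where
  βx : litVal β x ≡ true
  βx with All.lookup βG x∈
  ... | here βx = βx

data R1Result (F : ClauseSet) (ρ : PAss) (r : ClauseSet) : Set where
  r1-bot   : r ≡ [ [] ] → ¬ Sat (apply ρ F) → R1Result F ρ r
  r1-fixed : ∀ ρ' → ρ ⊑ ρ' → r ≡ apply ρ' F → [] ∉ apply ρ' F → (∀ l → [ l ] ∉ apply ρ' F) →
             R1Result F ρ r

-- r₁ with fuel exceeding the size: each step either stops or propagates a
-- unit clause, which keeps satisfiability and strictly decreases the size
r1-fuel-result : ∀ F k ρ → size (apply ρ F) < k → R1Result F ρ (r1-fuel k (apply ρ F))
r1-fuel-result F (suc k) ρ enough with any isEmpty (apply ρ F) in has-empty
... | true = r1-bot refl λ sat →
  let C , C∈ , C-empty = any-true isEmpty (apply ρ F) has-empty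
  in empty-unsat _ (subst (_∈ apply ρ F) (isEmpty-[] C C-empty) C∈) sat
... | false with findUnit (apply ρ F) in unit
...   | nothing = r1-fixed ρ (λ _ _ ρv → ρv) refl
                  (λ []∈ → true≢false (any-false isEmpty (apply ρ F) has-empty [] []∈))
                  (findUnit-nothing (apply ρ F) unit)
  where
  true≢false : true ≡ false → ⊥
  true≢false ()
...   | just x rewrite apply-▷ ρ (single x true) F with r1-fuel-result F k (ρ ▷ single x true) smaller
  where
  smaller : size (apply (ρ ▷ single x true) F) < k
  smaller = <-≤-trans (subst (λ G → size G < size (apply ρ F)) (apply-▷ ρ (single x true) F)
                                  (size-unit (apply ρ F) x unit))
                      (≤-pred enough)
...     | r1-bot eq unsat = r1-bot eq (λ sat → unsat (subst Sat (apply-▷ ρ (single x true) F)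
                                          (unit-sat (apply ρ F) x (findUnit-just _ x unit) sat)))
...     | r1-fixed ρ' ext eq no-empty no-unit = r1-fixed ρ' (⊑-trans (⊑-▷ ρ (single x true)) ext) eq no-empty no-unit

r1-result : ∀ F ρ → R1Result F ρ (r1 (apply ρ F))
r1-result F ρ = r1-fuel-result F (suc (size (apply ρ F))) ρ ≤-refl

xor-cancelˡ : ∀ a b → a xor (a xor b) ≡ b
xor-cancelˡ false b = refl
xor-cancelˡ true b = not-involutive b

xor-false⇒≡ : ∀ a b → a xor b ≡ false → a ≡ b
xor-false⇒≡ a b ab = trans (sym (xor-identityʳ a)) (trans (cong (a xor_) (sym ab)) (xor-cancelˡ a b))

≡⇒xor-false : ∀ a b → a ≡ b → a xor b ≡ false
≡⇒xor-false a b refl = xor-same a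

xorVal₃ : ∀ γ a b c → xorVal γ (a ∷ b ∷ c ∷ []) ≡ litVal γ a xor (litVal γ b xor litVal γ c)
xorVal₃ γ a b c = cong (λ t → litVal γ a xor (litVal γ b xor t)) (xor-identityʳ (litVal γ c))

xorVal-cong : ∀ γ γ' D → (∀ u → u ∈ varsC D → γ u ≡ γ' u) → xorVal γ D ≡ xorVal γ' D
xorVal-cong γ γ' [] _ = refl
xorVal-cong γ γ' (l ∷ D) agree =
  cong₂ _xor_ (litVal-cong γ γ' l (agree (var l) (here refl))) (xorVal-cong γ γ' D (λ u u∈ → agree u (there u∈)))

-- X₀(D) is the CNF of the XOR constraint D

allSigns-∈⁺ : ∀ C → C ∈ allSigns (varsC C)
allSigns-∈⁺ [] = here refl
allSigns-∈⁺ (pos v ∷ C) = ∈-++⁺ˡ (∈-map⁺ (pos v ∷_) (allSigns-∈⁺ C))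
allSigns-∈⁺ (neg v ∷ C) = ∈-++⁺ʳ (map (pos v ∷_) (allSigns (varsC C))) (∈-map⁺ (neg v ∷_) (allSigns-∈⁺ C))

allSigns-∈⁻ : ∀ vs C → C ∈ allSigns vs → varsC C ≡ vs
allSigns-∈⁻ [] C (here refl) = refl
allSigns-∈⁻ (v ∷ vs) C C∈ with ∈-++⁻ (map (pos v ∷_) (allSigns vs)) C∈
... | inj₁ C∈pos with ∈-map⁻ (pos v ∷_) C∈pos
...   | C' , C'∈ , refl = cong (v ∷_) (allSigns-∈⁻ vs C' C'∈)
allSigns-∈⁻ (v ∷ vs) C C∈ | inj₂ C∈neg with ∈-map⁻ (neg v ∷_) C∈neg
...   | C' , C'∈ , refl = cong (v ∷_) (allSigns-∈⁻ vs C' C'∈)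

X0-∈⁺ : ∀ C D → varsC C ≡ varsC D → negParity C xor negParity D ≡ true → C ∈ X0 D
X0-∈⁺ C D same-vars parity =
  filterᵇ-∈⁺ (λ E → negParity E xor negParity D) (allSigns (varsC D))
             (subst (λ vs → C ∈ allSigns vs) same-vars (allSigns-∈⁺ C)) parity

X0-∈⁻ : ∀ C D → C ∈ X0 D → (varsC C ≡ varsC D) × (negParity C xor negParity D ≡ true)
X0-∈⁻ C D C∈ with filterᵇ-∈⁻ (λ E → negParity E xor negParity D) (allSigns (varsC D)) C∈
... | C∈all , parity = allSigns-∈⁻ (varsC D) C C∈all , parity

xorVal-falsified : ∀ γ C D → varsC C ≡ varsC D → All (λ l → litVal γ l ≡ false) C →
  xorVal γ D ≡ negParity C xor negParity D
xorVal-falsified γ [] [] _ [] = refl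
xorVal-falsified γ (c ∷ C) (d ∷ D) same-vars (γc ∷ γC) =
  begin
    litVal γ d xor xorVal γ D
  ≡⟨ cong₂ _xor_ (litVal-xor γ d) (xorVal-falsified γ C D (∷-injectiveʳ same-vars) γC) ⟩
    (γ (var d) xor isNeg d) xor (negParity C xor negParity D)
  ≡⟨ cong (λ b → (b xor isNeg d) xor (negParity C xor negParity D)) γd ⟩
    (isNeg c xor isNeg d) xor (negParity C xor negParity D)
  ≡⟨ interchange (isNeg c) (isNeg d) (negParity C) (negParity D) ⟩
    (isNeg c xor negParity C) xor (isNeg d xor negParity D)
  ∎
  where
  open ≡-Reasoning
  γd : γ (var d) ≡ isNeg c
  γd = trans (cong γ (sym (∷-injectiveˡ same-vars)))
             (xor-false⇒≡ _ _ (trans (sym (litVal-xor γ c)) γc))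

falsifier : TAss → Clause → Clause
falsifier γ D = map (λ d → if γ (var d) then neg (var d) else pos (var d)) D

falsifier-vars : ∀ γ D → varsC (falsifier γ D) ≡ varsC D
falsifier-vars γ [] = refl
falsifier-vars γ (d ∷ D) with γ (var d)
... | true = cong (var d ∷_) (falsifier-vars γ D)
... | false = cong (var d ∷_) (falsifier-vars γ D)

falsifier-false : ∀ γ D → All (λ l → litVal γ l ≡ false) (falsifier γ D)
falsifier-false γ [] = []
falsifier-false γ (d ∷ D) with γ (var d) in γd
... | true = cong not γd ∷ falsifier-false γ D
... | false = γd ∷ falsifier-false γ D

falsifier-∈-X0 : ∀ γ D → xorVal γ D ≡ true → falsifier γ D ∈ X0 D
falsifier-∈-X0 γ D violated =
  X0-∈⁺ (falsifier γ D) D (falsifier-vars γ D)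
        (trans (sym (xorVal-falsified γ (falsifier γ D) D (falsifier-vars γ D) (falsifier-false γ D))) violated)

X0-sound : ∀ γ D → SatBy γ (X0 D) → xorVal γ D ≡ false
X0-sound γ D γX0 with xorVal γ D in violated
... | false = refl
... | true with find (All.lookup γX0 (falsifier-∈-X0 γ D violated))
...   | l , l∈ , γl with trans (sym γl) (All.lookup (falsifier-false γ D) l∈)
...     | ()

X0-complete : ∀ γ D → xorVal γ D ≡ false → SatBy γ (X0 D)
X0-complete γ D γD = All.tabulate some-true
  where
  some-true : ∀ {C} → C ∈ X0 D → Any (λ l → litVal γ l ≡ true) C
  some-true {C} C∈ with Any.any? (λ l → litVal γ l Data.Bool.≟ true) C
  ... | yes some = some
  ... | no none with X0-∈⁻ C D C∈
  ...   | same-vars , parity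
    with trans (sym γD) (trans (xorVal-falsified γ C D same-vars (All.tabulate all-false)) parity)
    where
    all-false : ∀ {l} → l ∈ C → litVal γ l ≡ false
    all-false {l} l∈ with litVal γ l in γl
    ... | false = refl
    ... | true = ⊥-elim (none (lose l∈ γl))
  ...     | ()

flip-head : Clause → Clause
flip-head [] = []
flip-head (pos v ∷ D) = neg v ∷ D
flip-head (neg v ∷ D) = pos v ∷ D

flip-head-∈-X0 : ∀ d D → flip-head (d ∷ D) ∈ X0 (d ∷ D)
flip-head-∈-X0 (pos v) D = X0-∈⁺ (neg v ∷ D) (pos v ∷ D) refl (xor-inverseˡ (negParity D))
flip-head-∈-X0 (neg v) D = X0-∈⁺ (pos v ∷ D) (neg v ∷ D) refl (xor-inverseʳ (negParity D))

flip-head-vars : ∀ D → varsC (flip-head D) ≡ varsC D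
flip-head-vars [] = refl
flip-head-vars (pos v ∷ D) = refl
flip-head-vars (neg v ∷ D) = refl

openVars : PAss → Clause → List ℕ
openVars ρ D = varsC (filterᵇ (unassigned ρ) D)

openVars-cong : ∀ ρ C D → varsC C ≡ varsC D → openVars ρ C ≡ openVars ρ D
openVars-cong ρ [] [] _ = refl
openVars-cong ρ (c ∷ C) (d ∷ D) same
  rewrite filterᵇ-cons (unassigned ρ) c C | filterᵇ-cons (unassigned ρ) d D
        | unassigned-var ρ c | unassigned-var ρ d | ∷-injectiveˡ same with isUnassigned (ρ (var d))
... | true = cong₂ _∷_ (∷-injectiveˡ same) (openVars-cong ρ C D (∷-injectiveʳ same))
... | false = openVars-cong ρ C D (∷-injectiveʳ same)

openVars-⊆ : ∀ ρ (D : Clause) u → u ∈ openVars ρ D → u ∈ varsC D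
openVars-⊆ ρ D u u∈ with ∈-map⁻ var u∈
... | l , l∈ , refl = ∈-map⁺ var (proj₁ (filterᵇ-∈⁻ (unassigned ρ) D l∈))

openVars-unique : ∀ ρ (D : Clause) → Unique (varsC D) → Unique (openVars ρ D)
openVars-unique ρ [] _ = []
openVars-unique ρ (l ∷ D) (l∉ ∷ uniq) rewrite filterᵇ-cons (unassigned ρ) l D with unassigned ρ l
... | true = All.tabulate (λ {u} u∈ → All.lookup l∉ (openVars-⊆ ρ D u u∈)) ∷ openVars-unique ρ D uniq
... | false = openVars-unique ρ D uniq

xorVars : TAss → List ℕ → Bool
xorVars β [] = false
xorVars β (u ∷ us) = β u xor xorVars β us

fixedPart : PAss → Clause → Bool
fixedPart ρ D = xorVal (complete ρ (λ _ → false)) D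

Solves : PAss → TAss → Clause → Set
Solves ρ β D = xorVal (complete ρ β) D ≡ false

xorVal-split : ∀ ρ β D → xorVal (complete ρ β) D ≡ fixedPart ρ D xor xorVars β (openVars ρ D)
xorVal-split ρ β [] = refl
xorVal-split ρ β (l ∷ D) rewrite filterᵇ-cons (unassigned ρ) l D with plitVal ρ l in ρl
... | just b rewrite plitVal-just ρ β l b ρl | plitVal-just ρ (λ _ → false) l b ρl | xorVal-split ρ β D =
      sym (xor-assoc b (fixedPart ρ D) (xorVars β (openVars ρ D)))
... | nothing rewrite plitVal-nothing ρ β l ρl | plitVal-nothing ρ (λ _ → false) l ρl | xorVal-split ρ β D
                    | litVal-xor β l | litVal-xor (λ _ → false) l =
      trans (cong (_xor (fixedPart ρ D xor xorVars β (openVars ρ D))) (xor-comm (β (var l)) (isNeg l)))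
            (interchange (isNeg l) (β (var l)) (fixedPart ρ D) (xorVars β (openVars ρ D)))

update : TAss → ℕ → Bool → TAss
update β q x u = if does (u ℕ.≟ q) then x else β u

update-same : ∀ β q x → update β q x q ≡ x
update-same β q x = if-yes (q ℕ.≟ q) refl

update-other : ∀ β q x u → u ≢ q → update β q x u ≡ β u
update-other β q x u u≢q = if-no (u ℕ.≟ q) u≢q

xorVars-cong : ∀ β β' us → (∀ u → u ∈ us → β u ≡ β' u) → xorVars β us ≡ xorVars β' us
xorVars-cong β β' [] _ = refl
xorVars-cong β β' (u ∷ us) agree = cong₂ _xor_ (agree u (here refl)) (xorVars-cong β β' us (λ u' u'∈ → agree u' (there u'∈)))

xorVars-update : ∀ β q x us → Unique us → q ∈ us → xorVars (update β q x) us ≡ xorVars β us xor (β q xor x)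
xorVars-update β q x (u ∷ us) (u∉us ∷ _) (here refl)
  rewrite update-same β u x
        | xorVars-cong (update β u x) β us (λ u' u'∈ → update-other β u x u' (λ u'≡u → All¬⇒¬Any u∉us (subst (_∈ us) u'≡u u'∈))) =
  begin
    x xor xorVars β us
  ≡⟨ xor-comm x (xorVars β us) ⟩
    xorVars β us xor x
  ≡⟨ cong (_xor (xorVars β us xor x)) (sym (xor-same (β u))) ⟩
    (β u xor β u) xor (xorVars β us xor x)
  ≡⟨ interchange (β u) (β u) (xorVars β us) x ⟩
    (β u xor xorVars β us) xor (β u xor x)
  ∎
  where open ≡-Reasoning
xorVars-update β q x (u ∷ us) (u∉us ∷ uniq) (there q∈)
  rewrite update-other β q x u (λ u≡q → All¬⇒¬Any u∉us (subst (_∈ us) (sym u≡q) q∈))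
        | xorVars-update β q x us uniq q∈ =
  sym (xor-assoc (β u) (xorVars β us) (β q xor x))

Flexible : PAss → Clause → Set
Flexible ρ D = (∃₂ λ p p' → ∃ λ r → openVars ρ D ≡ p ∷ p' ∷ r) ⊎
               ((openVars ρ D ≡ []) × (fixedPart ρ D ≡ false))

Solvable1 : PAss → Clause → Set
Solvable1 ρ D = ∀ v b → ∃ λ β → Solves ρ β D × (β v ≡ b)

-- a flexible constraint is solvable: start from the constant b and correct
-- the parity on an open variable different from v
flexible-solvable : ∀ ρ D → Unique (openVars ρ D) → Flexible ρ D → Solvable1 ρ D
flexible-solvable ρ D _ (inj₂ (no-open , holds)) v b =
  (λ _ → b) ,
  trans (xorVal-split ρ (λ _ → b) D)
        (subst (λ us → fixedPart ρ D xor xorVars (λ _ → b) us ≡ false) (sym no-open)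
               (trans (xor-identityʳ (fixedPart ρ D)) holds)) ,
  refl
flexible-solvable ρ D uniq (inj₁ (p , p' , r , two-open)) v b = β , solves , update-other _ q _ v v≢q
  where
  p≢p' : p ≢ p'
  p≢p' with subst Unique two-open uniq
  ... | (p≢p' ∷ _) ∷ _ = p≢p'
  other : ∃ λ q → (q ∈ openVars ρ D) × (v ≢ q)
  other with p ℕ.≟ v
  ... | yes refl = p' , subst (p' ∈_) (sym two-open) (there (here refl)) , p≢p'
  ... | no p≢v = p , subst (p ∈_) (sym two-open) (here refl) , (λ v≡p → p≢v (sym v≡p))
  q = proj₁ other
  v≢q = proj₂ (proj₂ other)
  parity = fixedPart ρ D xor xorVars (λ _ → b) (openVars ρ D)
  β = update (λ _ → b) q (b xor parity)
  solves : Solves ρ β D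
  solves =
    begin
      xorVal (complete ρ β) D
    ≡⟨ xorVal-split ρ β D ⟩
      fixedPart ρ D xor xorVars β (openVars ρ D)
    ≡⟨ cong (fixedPart ρ D xor_) (xorVars-update (λ _ → b) q (b xor parity) (openVars ρ D) uniq (proj₁ (proj₂ other))) ⟩
      fixedPart ρ D xor (xorVars (λ _ → b) (openVars ρ D) xor (b xor (b xor parity)))
    ≡⟨ cong (λ t → fixedPart ρ D xor (xorVars (λ _ → b) (openVars ρ D) xor t)) (xor-cancelˡ b parity) ⟩
      fixedPart ρ D xor (xorVars (λ _ → b) (openVars ρ D) xor parity)
    ≡⟨ xor-assoc (fixedPart ρ D) (xorVars (λ _ → b) (openVars ρ D)) parity ⟨
      parity xor parity
    ≡⟨ xor-same parity ⟩
      false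
    ∎
    where open ≡-Reasoning

-- Gluing solutions of blocks that share at most one variable

Solvable : PAss → ClauseSet → Set
Solvable ρ B = ∀ v b → ∃ λ β → All (Solves ρ β) B × (β v ≡ b)

MeetsInOne : ClauseSet → ClauseSet → Set
MeetsInOne B S = ∃ λ w → ∀ u → u ∈ vars B → u ∈ vars S → u ≡ w

data Forest (ρ : PAss) : List ClauseSet → Set where
  []  : Forest ρ []
  _∷_ : ∀ {B Bs} → MeetsInOne B (concat Bs) × Solvable ρ B → Forest ρ Bs → Forest ρ (B ∷ Bs)

solves-cong : ∀ ρ β β' D → (∀ u → u ∈ varsC D → β u ≡ β' u) → Solves ρ β D → Solves ρ β' D
solves-cong ρ β β' D agree =
  trans (sym (xorVal-cong (complete ρ β) (complete ρ β') D (λ u u∈ → cong (λ b → fromMaybe b (ρ u)) (agree u u∈))))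

∈-vars : ∀ {u D} B → D ∈ B → u ∈ varsC D → u ∈ vars B
∈-vars B D∈ u∈ = ∈-concatMap⁺ varsC (lose D∈ u∈)

glue : ∀ ρ B S w → (∀ u → u ∈ vars B → u ∈ vars S → u ≡ w) → ∀ v b βB βS →
       All (Solves ρ βB) B → All (Solves ρ βS) S → βB w ≡ βS w →
       (v ∈ vars B → βB v ≡ b) → (v ∉ vars B → βS v ≡ b) →
       ∃ λ β → All (Solves ρ β) (B ++ S) × (β v ≡ b)
glue ρ B S w meet v b βB βS solB solS agree-w vB vS =
  β ,
  ++⁺ (All.tabulate (λ {D} D∈ → solves-cong ρ βB β D (λ u u∈ → on-B u (∈-vars B D∈ u∈)) (All.lookup solB D∈)))
      (All.tabulate (λ {D} D∈ → solves-cong ρ βS β D (λ u u∈ → on-S u (∈-vars S D∈ u∈)) (All.lookup solS D∈))) ,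
  on-v
  where
  β : TAss
  β u = if does (u ∈? vars B) then βB u else βS u
  on-B : ∀ u → u ∈ vars B → βB u ≡ β u
  on-B u u∈ = sym (if-yes (u ∈? vars B) u∈)
  on-S : ∀ u → u ∈ vars S → βS u ≡ β u
  on-S u u∈S with u ∈? vars B
  ... | yes u∈B rewrite meet u u∈B u∈S = sym agree-w
  ... | no _ = refl
  on-v : β v ≡ b
  on-v with v ∈? vars B
  ... | yes v∈ = vB v∈
  ... | no v∉ = vS v∉

-- a forest of solvable blocks is solvable: solve the first block and the rest,
-- starting on the side of v and matching the shared variable on the other
forest-solvable : ∀ ρ Bs → Forest ρ Bs → Solvable ρ (concat Bs)
forest-solvable ρ [] [] v b = (λ _ → b) , [] , refl
forest-solvable ρ (B ∷ Bs) (((w , meet) , solvB) ∷ rest) v b with v ∈? vars B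
... | yes v∈ =
  let βB , solB , βBv = solvB v b
      βS , solS , βSw = forest-solvable ρ Bs rest w (βB w)
  in glue ρ B (concat Bs) w meet v b βB βS solB solS (sym βSw) (λ _ → βBv) (λ v∉ → ⊥-elim (v∉ v∈))
... | no v∉ =
  let βS , solS , βSv = forest-solvable ρ Bs rest v b
      βB , solB , βBw = solvB w (βS w)
  in glue ρ B (concat Bs) w meet v b βB βS solB solS βBw (λ v∈ → ⊥-elim (v∉ v∈)) (λ _ → βSv)

data Linear : ClauseSet → Set where
  []  : Linear []
  _∷_ : ∀ {D Ds} → MeetsInOne [ D ] Ds → Linear Ds → Linear (D ∷ Ds)

concat-singletons : (xs : List A) → concat (map [_] xs) ≡ xs
concat-singletons [] = refl
concat-singletons (x ∷ xs) = cong (x ∷_) (concat-singletons xs)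

linear-solvable : ∀ ρ Ds → Linear Ds → (∀ D → D ∈ Ds → Solvable1 ρ D) → Solvable ρ Ds
linear-solvable ρ Ds lin solv1 =
  subst (Solvable ρ) (concat-singletons Ds) (forest-solvable ρ (map [_] Ds) (singletons Ds lin solv1))
  where
  singletons : ∀ Ds → Linear Ds → (∀ D → D ∈ Ds → Solvable1 ρ D) → Forest ρ (map [_] Ds)
  singletons [] [] _ = []
  singletons (D ∷ Ds) ((w , meet) ∷ lin) solv1 =
    ((w , λ u u∈D u∈Ds → meet u u∈D (subst (λ G → u ∈ vars G) (concat-singletons Ds) u∈Ds)) ,
     (λ v b → let β , solD , βv = solv1 D (here refl) v b in β , solD ∷ [] , βv)) ∷
    singletons Ds lin (λ D' D'∈ → solv1 D' (there D'∈))

-- The natural splitting of one clause, with injective new variables y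

module Splitting (y : ℕ → ℕ) (y-inj : ∀ j k → y j ≡ y k → j ≡ k) where

  y-distinct : ∀ j k → j < k → y j ≢ y k
  y-distinct j k j<k yj≡yk with y-inj j k yj≡yk
  ... | refl = <-irrefl refl j<k

  chain : ℕ → Lit → List Lit → ClauseSet
  chain i p [] = []
  chain i p (x ∷ []) = (p ∷ x ∷ []) ∷ []
  chain i p (x ∷ x' ∷ r) = (p ∷ x ∷ pos (y i) ∷ []) ∷ chain (suc i) (pos (y i)) (x' ∷ r)

  splitChain-chain : ∀ i prev xs → splitChain y i prev xs ≡ chain i (pos prev) xs
  splitChain-chain i prev [] = refl
  splitChain-chain i prev (x ∷ []) = refl
  splitChain-chain i prev (x ∷ x' ∷ r) = cong (_ ∷_) (splitChain-chain (suc i) (y i) (x' ∷ r))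

  naturalSplit-chain : ∀ a b r → naturalSplit y (a ∷ b ∷ r) ≡ chain 2 a (b ∷ r)
  naturalSplit-chain a b [] = refl
  naturalSplit-chain a b (c ∷ r) = cong (_ ∷_) (splitChain-chain 3 (y 2) (c ∷ r))

  record ChainFresh (i : ℕ) (p : Lit) (xs : List Lit) : Set where
    field
      xs-unique : Unique (varsC xs)
      p∉xs      : var p ∉ varsC xs
      p-not-y   : ∀ j → i ≤ j → var p ≢ y j
      y∉xs      : ∀ j → y j ∉ varsC xs
  open ChainFresh

  fresh-tail : ∀ {i p x x' r} → ChainFresh i p (x ∷ x' ∷ r) → ChainFresh (suc i) (pos (y i)) (x' ∷ r)
  fresh-tail {i} fr with xs-unique fr
  ... | _ ∷ uniq = record
    { xs-unique = uniq
    ; p∉xs = λ yi∈ → y∉xs fr i (there yi∈)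
    ; p-not-y = λ j i<j → y-distinct i j i<j
    ; y∉xs = λ j yj∈ → y∉xs fr j (there yj∈)
    }

  split-fresh : ∀ a b r → Unique (varsC (a ∷ b ∷ r)) → (∀ j → y j ∉ varsC (a ∷ b ∷ r)) → ChainFresh 2 a (b ∷ r)
  split-fresh a b r (a∉ ∷ uniq) y∉ = record
    { xs-unique = uniq
    ; p∉xs = All¬⇒¬Any a∉
    ; p-not-y = λ j _ a≡yj → y∉ j (subst (_∈ varsC (a ∷ b ∷ r)) a≡yj (here refl))
    ; y∉xs = λ j yj∈ → y∉ j (there yj∈)
    }

  chain-vars : ∀ i p xs u → u ∈ vars (chain i p xs) →
               (u ≡ var p) ⊎ (u ∈ varsC xs) ⊎ (∃ λ j → (i ≤ j) × (u ≡ y j))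
  chain-vars i p (x ∷ []) u (here refl) = inj₁ refl
  chain-vars i p (x ∷ []) u (there (here refl)) = inj₂ (inj₁ (here refl))
  chain-vars i p (x ∷ x' ∷ r) u (here refl) = inj₁ refl
  chain-vars i p (x ∷ x' ∷ r) u (there (here refl)) = inj₂ (inj₁ (here refl))
  chain-vars i p (x ∷ x' ∷ r) u (there (there (here refl))) = inj₂ (inj₂ (i , ≤-refl , refl))
  chain-vars i p (x ∷ x' ∷ r) u (there (there (there u∈))) with chain-vars (suc i) (pos (y i)) (x' ∷ r) u u∈
  ... | inj₁ u≡yi = inj₂ (inj₂ (i , ≤-refl , u≡yi))
  ... | inj₂ (inj₁ u∈xs) = inj₂ (inj₁ (there u∈xs))
  ... | inj₂ (inj₂ (j , i<j , u≡yj)) = inj₂ (inj₂ (j , ≤-trans (n≤1+n i) i<j , u≡yj))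

  chain-⊇ : ∀ i p xs u → u ∈ varsC xs → u ∈ vars (chain i p xs)
  chain-⊇ i p (x ∷ []) u (here refl) = there (here refl)
  chain-⊇ i p (x ∷ x' ∷ r) u (here refl) = there (here refl)
  chain-⊇ i p (x ∷ x' ∷ r) u (there u∈) = there (there (there (chain-⊇ (suc i) (pos (y i)) (x' ∷ r) u u∈)))

  split-vars : ∀ C u → u ∈ vars (naturalSplit y C) → (u ∈ varsC C) ⊎ (∃ λ j → u ≡ y j)
  split-vars [] u ()
  split-vars (a ∷ []) u (here refl) = inj₁ (here refl)
  split-vars (a ∷ b ∷ r) u u∈ with chain-vars 2 a (b ∷ r) u (subst (λ G → u ∈ vars G) (naturalSplit-chain a b r) u∈)
  ... | inj₁ refl = inj₁ (here refl)
  ... | inj₂ (inj₁ u∈) = inj₁ (there u∈)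
  ... | inj₂ (inj₂ (j , _ , u≡yj)) = inj₂ (j , u≡yj)

  split-⊇ : ∀ C u → u ∈ varsC C → u ∈ vars (naturalSplit y C)
  split-⊇ (a ∷ []) u (here refl) = here refl
  split-⊇ (a ∷ b ∷ []) u (here refl) = here refl
  split-⊇ (a ∷ b ∷ _ ∷ _) u (here refl) = here refl
  split-⊇ (a ∷ b ∷ r) u (there u∈) =
    subst (λ G → u ∈ vars G) (sym (naturalSplit-chain a b r)) (chain-⊇ 2 a (b ∷ r) u u∈)

  chain-sound : ∀ γ i p x xs → XSat γ (chain i p (x ∷ xs)) → litVal γ p ≡ xorVal γ (x ∷ xs)
  chain-sound γ i p x [] (piece ∷ []) = xor-false⇒≡ _ _ piece
  chain-sound γ i p x (x' ∷ r) (piece ∷ pieces) =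
    trans (xor-false⇒≡ _ _ (trans (sym (xorVal₃ γ p x (pos (y i)))) piece))
          (cong (litVal γ x xor_) (chain-sound γ (suc i) (pos (y i)) x' r pieces))

  split-sound : ∀ γ C → XSat γ (naturalSplit y C) → xorVal γ C ≡ false
  split-sound γ [] (holds ∷ []) = holds
  split-sound γ (a ∷ []) (holds ∷ []) = holds
  split-sound γ (a ∷ b ∷ r) pieces =
    ≡⇒xor-false _ _ (chain-sound γ 2 a b r (subst (XSat γ) (naturalSplit-chain a b r) pieces))

  chain-determined : ∀ γ γ' i p xs → XSat γ (chain i p xs) → XSat γ' (chain i p xs) →
    γ (var p) ≡ γ' (var p) → (∀ u → u ∈ varsC xs → γ u ≡ γ' u) →
    ∀ u → u ∈ vars (chain i p xs) → γ u ≡ γ' u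
  chain-determined γ γ' i p (x ∷ []) _ _ on-p on-xs u (here refl) = on-p
  chain-determined γ γ' i p (x ∷ []) _ _ on-p on-xs u (there (here refl)) = on-xs u (here refl)
  chain-determined γ γ' i p (x ∷ x' ∷ r) (_ ∷ pieces) (_ ∷ pieces') on-p on-xs = on-chain
    where
    on-rest : ∀ u → u ∈ varsC (x' ∷ r) → γ u ≡ γ' u
    on-rest u u∈ = on-xs u (there u∈)
    on-yi : γ (y i) ≡ γ' (y i)
    on-yi = trans (chain-sound γ (suc i) (pos (y i)) x' r pieces)
           (trans (xorVal-cong γ γ' (x' ∷ r) on-rest)
                  (sym (chain-sound γ' (suc i) (pos (y i)) x' r pieces')))
    on-chain : ∀ u → u ∈ vars (chain i p (x ∷ x' ∷ r)) → γ u ≡ γ' u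
    on-chain u (here refl) = on-p
    on-chain u (there (here refl)) = on-xs u (here refl)
    on-chain u (there (there (here refl))) = on-yi
    on-chain u (there (there (there u∈))) =
      chain-determined γ γ' (suc i) (pos (y i)) (x' ∷ r) pieces pieces' on-yi on-rest u u∈

  split-determined : ∀ γ γ' C → XSat γ (naturalSplit y C) → XSat γ' (naturalSplit y C) →
    (∀ u → u ∈ varsC C → γ u ≡ γ' u) → ∀ u → u ∈ vars (naturalSplit y C) → γ u ≡ γ' u
  split-determined γ γ' [] _ _ on-C u u∈ = on-C u (subst (u ∈_) (++-identityʳ []) u∈)
  split-determined γ γ' (a ∷ []) _ _ on-C u u∈ = on-C u (subst (u ∈_) (++-identityʳ (var a ∷ [])) u∈)
  split-determined γ γ' (a ∷ b ∷ r) pieces pieces' on-C u u∈ =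
    chain-determined γ γ' 2 a (b ∷ r) (subst (XSat γ) (naturalSplit-chain a b r) pieces)
      (subst (XSat γ') (naturalSplit-chain a b r) pieces') (on-C (var a) (here refl))
      (λ u' u'∈ → on-C u' (there u'∈)) u (subst (λ G → u ∈ vars G) (naturalSplit-chain a b r) u∈)

  chain-solution : TAss → ℕ → List Lit → TAss
  chain-solution γ i (x ∷ x' ∷ r) = chain-solution (update γ (y i) (xorVal γ (x' ∷ r))) (suc i) (x' ∷ r)
  chain-solution γ i _ = γ

  chain-solution-off : ∀ γ i xs u → (∀ j → i ≤ j → u ≢ y j) → chain-solution γ i xs u ≡ γ u
  chain-solution-off γ i [] u _ = refl
  chain-solution-off γ i (x ∷ []) u _ = refl
  chain-solution-off γ i (x ∷ x' ∷ r) u not-y =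
    trans (chain-solution-off _ (suc i) (x' ∷ r) u (λ j i<j → not-y j (≤-trans (n≤1+n i) i<j)))
          (update-other γ (y i) _ u (not-y i ≤-refl))

  chain-solution-sat : ∀ γ i p xs → ChainFresh i p xs → litVal γ p ≡ xorVal γ xs →
    XSat (chain-solution γ i xs) (chain i p xs)
  chain-solution-sat γ i p [] _ _ = []
  chain-solution-sat γ i p (x ∷ []) _ p≡x = ≡⇒xor-false _ _ p≡x ∷ []
  chain-solution-sat γ i p (x ∷ x' ∷ r) fr p≡xs = head ∷ chain-solution-sat γ₁ (suc i) (pos (y i)) (x' ∷ r) (fresh-tail fr) yi≡rest
    where
    rest = xorVal γ (x' ∷ r)
    γ₁ = update γ (y i) rest
    γ* = chain-solution γ₁ (suc i) (x' ∷ r)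
    yi≡rest : γ₁ (y i) ≡ xorVal γ₁ (x' ∷ r)
    yi≡rest = trans (update-same γ (y i) rest)
                    (xorVal-cong γ γ₁ (x' ∷ r) (λ u u∈ → sym (update-other γ (y i) rest u
                                      (λ u≡yi → y∉xs fr i (subst (_∈ varsC (x ∷ x' ∷ r)) u≡yi (there u∈))))))
    keeps : ∀ u → (∀ j → i ≤ j → u ≢ y j) → γ* u ≡ γ u
    keeps u not-y = trans (chain-solution-off γ₁ (suc i) (x' ∷ r) u (λ j i<j → not-y j (≤-trans (n≤1+n i) i<j)))
                          (update-other γ (y i) rest u (not-y i ≤-refl))
    x-not-y : ∀ j → i ≤ j → var x ≢ y j
    x-not-y j _ x≡yj = y∉xs fr j (subst (_∈ varsC (x ∷ x' ∷ r)) x≡yj (here refl))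
    head : xorVal γ* (p ∷ x ∷ pos (y i) ∷ []) ≡ false
    head rewrite xorVal₃ γ* p x (pos (y i))
               | litVal-cong γ* γ p (keeps (var p) (p-not-y fr))
               | litVal-cong γ* γ x (keeps (var x) x-not-y)
               | chain-solution-off γ₁ (suc i) (x' ∷ r) (y i) (λ j i<j → y-distinct i j i<j)
               | update-same γ (y i) rest = ≡⇒xor-false _ _ p≡xs

  split-solution : TAss → Clause → TAss
  split-solution γ (a ∷ b ∷ r) = chain-solution γ 2 (b ∷ r)
  split-solution γ C = γ

  split-solution-off : ∀ γ C u → (∀ j → u ≢ y j) → split-solution γ C u ≡ γ u
  split-solution-off γ [] u _ = refl
  split-solution-off γ (a ∷ []) u _ = refl
  split-solution-off γ (a ∷ b ∷ r) u not-y = chain-solution-off γ 2 (b ∷ r) u (λ j _ → not-y j)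

  split-solution-sat : ∀ γ C → Unique (varsC C) → (∀ j → y j ∉ varsC C) → xorVal γ C ≡ false →
    XSat (split-solution γ C) (naturalSplit y C)
  split-solution-sat γ [] _ _ holds = holds ∷ []
  split-solution-sat γ (a ∷ []) _ _ holds = holds ∷ []
  split-solution-sat γ (a ∷ b ∷ r) uniq y∉ holds =
    subst (XSat (split-solution γ (a ∷ b ∷ r))) (sym (naturalSplit-chain a b r))
          (chain-solution-sat γ 2 a (b ∷ r) (split-fresh a b r uniq y∉) (xor-false⇒≡ _ _ holds))

  chain-pieces-unique : ∀ i p xs → ChainFresh i p xs → All (λ D → Unique (varsC D)) (chain i p xs)
  chain-pieces-unique i p [] _ = []
  chain-pieces-unique i p (x ∷ []) fr = ((p≢x ∷ []) ∷ [] ∷ []) ∷ []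
    where
    p≢x : var p ≢ var x
    p≢x p≡x = p∉xs fr (subst (_∈ _) (sym p≡x) (here refl))
  chain-pieces-unique i p (x ∷ x' ∷ r) fr =
    ((p≢x ∷ p-not-y fr i ≤-refl ∷ []) ∷ (x≢yi ∷ []) ∷ [] ∷ []) ∷
    chain-pieces-unique (suc i) (pos (y i)) (x' ∷ r) (fresh-tail fr)
    where
    p≢x : var p ≢ var x
    p≢x p≡x = p∉xs fr (subst (_∈ _) (sym p≡x) (here refl))
    x≢yi : var x ≢ y i
    x≢yi x≡yi = y∉xs fr i (subst (_∈ _) x≡yi (here refl))

  -- the pieces of a chain are linear: a piece meets the later ones only in its last new variable
  chain-linear : ∀ i p xs → ChainFresh i p xs → Linear (chain i p xs)
  chain-linear i p [] _ = []
  chain-linear i p (x ∷ []) _ = (var p , λ _ _ ()) ∷ []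
  chain-linear i p (x ∷ x' ∷ r) fr = (y i , meet) ∷ chain-linear (suc i) (pos (y i)) (x' ∷ r) (fresh-tail fr)
    where
    rest-vars = chain-vars (suc i) (pos (y i)) (x' ∷ r)
    meet : ∀ u → u ∈ vars [ p ∷ x ∷ pos (y i) ∷ [] ] → u ∈ vars (chain (suc i) (pos (y i)) (x' ∷ r)) → u ≡ y i
    meet u (here refl) u∈rest with rest-vars u u∈rest
    ... | inj₁ p≡yi = ⊥-elim (p-not-y fr i ≤-refl p≡yi)
    ... | inj₂ (inj₁ p∈) = ⊥-elim (p∉xs fr (there p∈))
    ... | inj₂ (inj₂ (j , i<j , p≡yj)) = ⊥-elim (p-not-y fr j (≤-trans (n≤1+n i) i<j) p≡yj)
    meet u (there (here refl)) u∈rest with rest-vars u u∈rest | xs-unique fr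
    ... | inj₁ x≡yi | _ = ⊥-elim (y∉xs fr i (subst (_∈ _) x≡yi (here refl)))
    ... | inj₂ (inj₁ x∈) | x∉ ∷ _ = ⊥-elim (All¬⇒¬Any x∉ x∈)
    ... | inj₂ (inj₂ (j , _ , x≡yj)) | _ = ⊥-elim (y∉xs fr j (subst (_∈ _) x≡yj (here refl)))
    meet u (there (there (here refl))) _ = refl

  split-pieces-unique : ∀ C → Unique (varsC C) → (∀ j → y j ∉ varsC C) → All (λ D → Unique (varsC D)) (naturalSplit y C)
  split-pieces-unique [] uniq _ = uniq ∷ []
  split-pieces-unique (a ∷ []) uniq _ = uniq ∷ []
  split-pieces-unique (a ∷ b ∷ r) uniq y∉ =
    subst (All (λ D → Unique (varsC D))) (sym (naturalSplit-chain a b r))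
          (chain-pieces-unique 2 a (b ∷ r) (split-fresh a b r uniq y∉))

  split-linear : ∀ C → Unique (varsC C) → (∀ j → y j ∉ varsC C) → Linear (naturalSplit y C)
  split-linear [] _ _ = (0 , λ _ _ ()) ∷ []
  split-linear (a ∷ []) _ _ = (0 , λ _ _ ()) ∷ []
  split-linear (a ∷ b ∷ r) uniq y∉ =
    subst Linear (sym (naturalSplit-chain a b r)) (chain-linear 2 a (b ∷ r) (split-fresh a b r uniq y∉))

search : (P : A → Set) → (∀ x → Dec (P x)) → ∀ xs → (∃ λ x → (x ∈ xs) × P x) ⊎ (∀ x → x ∈ xs → ¬ P x)
search P P? xs with Any.any? P? xs
... | yes some = inj₁ (find some)
... | no none = inj₂ (λ x x∈ px → none (lose x∈ px))

search-below : (P : ℕ → Set) → (∀ m → Dec (P m)) → ∀ N → (∃ λ m → (m < N) × P m) ⊎ (∀ m → m < N → ¬ P m)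
search-below P P? N with search P P? (upTo N)
... | inj₁ (m , m∈ , pm) = let k , k<N , m≡k = ∈-applyUpTo⁻ (λ k → k) m∈ in inj₁ (m , subst (_< N) (sym m≡k) k<N , pm)
... | inj₂ none = inj₂ (λ m m<N → none m (∈-applyUpTo⁺ (λ k → k) m<N))

least : (P : ℕ → Set) → (∀ m → Dec (P m)) → ∀ B N → N ≤ B → P N → ∃ λ m → P m × (∀ k → k < m → ¬ P k)
least P P? B N N≤B pN with search-below P P? N
... | inj₂ none = N , pN , none
least P P? (suc B) N N≤B pN | inj₁ (j , j<N , pj) = least P P? B j (≤-pred (≤-trans j<N N≤B)) pj
least P P? zero (suc N) () pN | inj₁ _

-- Acyclic clause-sets: every set of clauses has a leaf, hence the clauses
-- can be listed so that each meets the later ones in at most one variable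

module LeafOrder (F : ClauseSet) where

  n = length F

  clauseVars : Fin n → List ℕ
  clauseVars i = varsC (lookup F i)

  DistinctOn : (ℕ → B) → ℕ → ℕ → Set
  DistinctOn f lo hi = ∀ a b → lo ≤ a → a < b → b ≤ hi → f a ≢ f b

  distinct-injective : ∀ (f : ℕ → B) s k → DistinctOn f s (s + suc k) →
    ∀ (i j : Fin (suc (suc k))) → f (s + toℕ i) ≡ f (s + toℕ j) → i ≡ j
  distinct-injective f s k distinct i j eq with <-cmp (toℕ i) (toℕ j)
  ... | tri≈ _ i≡j _ = Fin.toℕ-injective i≡j
  ... | tri< i<j _ _ = ⊥-elim (distinct (s + toℕ i) (s + toℕ j) (m≤m+n s _) (+-monoʳ-< s i<j)
                                        (+-monoʳ-≤ s (≤-pred (Fin.toℕ<n j))) eq)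
  ... | tri> _ _ j<i = ⊥-elim (distinct (s + toℕ j) (s + toℕ i) (m≤m+n s _) (+-monoʳ-< s j<i)
                                        (+-monoʳ-≤ s (≤-pred (Fin.toℕ<n i))) (sym eq))

  closed-walk-cycle : (u : ℕ → ℕ) (c : ℕ → Fin n) (s k : ℕ) →
    DistinctOn u s (s + suc k) → DistinctOn c s (s + suc k) →
    (∀ t → u t ∈ clauseVars (c t)) → (∀ t → u (suc t) ∈ clauseVars (c t)) →
    u s ∈ clauseVars (c (s + suc k)) → Cycle F
  closed-walk-cycle u c s k u-distinct c-distinct u∈c u'∈c closing = record
    { k = k
    ; vs = λ i → u (s + toℕ i)
    ; cs = λ i → c (s + toℕ i)
    ; vs-inj = λ {i} {j} → distinct-injective u s k u-distinct i j
    ; cs-inj = λ {i} {j} → distinct-injective c s k c-distinct i j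
    ; edge₁ = λ i → u∈c (s + toℕ i)
    ; edge₂ = edge₂
    }
    where
    next-below : ∀ (i : Fin (suc (suc k))) → toℕ i < suc k → toℕ (next i) ≡ suc (toℕ i)
    next-below i i<last = trans (Fin.toℕ-fromℕ< _) (m<n⇒m%n≡m (s≤s i<last))
    next-last : ∀ (i : Fin (suc (suc k))) → toℕ i ≡ suc k → toℕ (next i) ≡ 0
    next-last i i≡last = trans (Fin.toℕ-fromℕ< _) (trans (cong (λ t → suc t % suc (suc k)) i≡last) (n%n≡0 (suc (suc k))))
    edge₂ : ∀ i → u (s + toℕ (next i)) ∈ clauseVars (c (s + toℕ i))
    edge₂ i with m≤n⇒m<n∨m≡n (≤-pred (Fin.toℕ<n i))
    ... | inj₁ i<last rewrite next-below i i<last | +-suc s (toℕ i) = u'∈c (s + toℕ i)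
    ... | inj₂ i≡last rewrite next-last i i≡last | i≡last | +-identityʳ s = closing

  Shared : List (Fin n) → Fin n → ℕ → Set
  Shared R c u = Any (λ j → (j ≢ c) × (u ∈ clauseVars j)) R

  shared? : ∀ R c u → Dec (Shared R c u)
  shared? R c u = Any.any? (λ j → ¬? (j Fin.≟ c) ×-dec (u ∈? clauseVars j)) R

  IsLeaf : List (Fin n) → Fin n → Set
  IsLeaf R c = ∃ λ w → ∀ u → u ∈ clauseVars c → Shared R c u → u ≡ w

  Branching : List (Fin n) → Fin n → Set
  Branching R c = ∃₂ λ u₁ u₂ → (u₁ ≢ u₂) × (u₁ ∈ clauseVars c) × (u₂ ∈ clauseVars c) × Shared R c u₁ × Shared R c u₂

  leaf-or-branching : ∀ R c → IsLeaf R c ⊎ Branching R c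
  leaf-or-branching R c with search (Shared R c) (shared? R c) (clauseVars c)
  ... | inj₂ none = inj₁ (0 , λ u u∈ sh → ⊥-elim (none u u∈ sh))
  ... | inj₁ (u₁ , u₁∈ , sh₁) with search (λ u → Shared R c u × (u ≢ u₁))
                                          (λ u → shared? R c u ×-dec ¬? (u ℕ.≟ u₁)) (clauseVars c)
  ...   | inj₁ (u₂ , u₂∈ , sh₂ , u₂≢u₁) = inj₂ (u₁ , u₂ , (λ u₁≡u₂ → u₂≢u₁ (sym u₁≡u₂)) , u₁∈ , u₂∈ , sh₁ , sh₂)
  ...   | inj₂ none = inj₁ (u₁ , only-u₁)
    where
    only-u₁ : ∀ u → u ∈ clauseVars c → Shared R c u → u ≡ u₁
    only-u₁ u u∈ sh with u ℕ.≟ u₁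
    ... | yes u≡u₁ = u≡u₁
    ... | no u≢u₁ = ⊥-elim (none u u∈ (sh , u≢u₁))

  -- if every clause of a nonempty R is branching, a walk that never turns
  -- back must close a cycle
  module Walk (R : List (Fin n)) (branching : ∀ c → c ∈ R → Branching R c) (c₀ : Fin n) (c₀∈R : c₀ ∈ R) where

    Dart : Set
    Dart = Σ ℕ λ u → Σ (Fin n) λ c → (u ∈ clauseVars c) × (c ∈ R)

    step : ∀ (d : Dart) → Σ Dart λ d' → (proj₁ d' ∈ clauseVars (proj₁ (proj₂ d))) ×
                                        (proj₁ d' ≢ proj₁ d) × (proj₁ (proj₂ d') ≢ proj₁ (proj₂ d))
    step (u , c , u∈c , c∈R) with branching c c∈R
    ... | u₁ , u₂ , u₁≢u₂ , u₁∈ , u₂∈ , sh₁ , sh₂ with u₁ ℕ.≟ u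
    ...   | yes u₁≡u = let j , j∈R , j≢c , u₂∈j = find sh₂ in
                       (u₂ , j , u₂∈j , j∈R) , u₂∈ , (λ u₂≡u → u₁≢u₂ (trans u₁≡u (sym u₂≡u))) , j≢c
    ...   | no u₁≢u = let j , j∈R , j≢c , u₁∈j = find sh₁ in
                      (u₁ , j , u₁∈j , j∈R) , u₁∈ , u₁≢u , j≢c

    start : Dart
    start with branching c₀ c₀∈R
    ... | u₁ , _ , _ , u₁∈ , _ = u₁ , c₀ , u₁∈ , c₀∈R

    walk : ℕ → Dart
    walk zero = start
    walk (suc t) = proj₁ (step (walk t))

    U : ℕ → ℕ
    U t = proj₁ (walk t)

    C : ℕ → Fin n
    C t = proj₁ (proj₂ (walk t))

    U∈C : ∀ t → U t ∈ clauseVars (C t)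
    U∈C t = proj₁ (proj₂ (proj₂ (walk t)))

    U'∈C : ∀ t → U (suc t) ∈ clauseVars (C t)
    U'∈C t = proj₁ (proj₂ (step (walk t)))

    U-turns : ∀ t → U (suc t) ≢ U t
    U-turns t = proj₁ (proj₂ (proj₂ (step (walk t))))

    C-turns : ∀ t → C (suc t) ≢ C t
    C-turns t = proj₂ (proj₂ (proj₂ (step (walk t))))

    Repeat : ℕ → Set
    Repeat m = (∃ λ j → (j < m) × (U j ≡ U m)) ⊎ (∃ λ j → (j < m) × (C j ≡ C m))

    repeat? : ∀ m → Dec (Repeat m)
    repeat? m with search-below (λ j → U j ≡ U m) (λ j → U j ℕ.≟ U m) m
                 | search-below (λ j → C j ≡ C m) (λ j → C j Fin.≟ C m) m
    ... | inj₁ rep | _ = yes (inj₁ rep)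
    ... | inj₂ _ | inj₁ rep = yes (inj₂ rep)
    ... | inj₂ no-U | inj₂ no-C = no λ { (inj₁ (j , j<m , eq)) → no-U j j<m eq ; (inj₂ (j , j<m , eq)) → no-C j j<m eq }

    some-repeat : ∃ λ m → (m ≤ n) × Repeat m
    some-repeat with Fin.pigeonhole (n<1+n n) (λ t → C (toℕ t))
    ... | i , j , i<j , eq = toℕ j , ≤-pred (Fin.toℕ<n j) , inj₂ (toℕ i , i<j , eq)

    two-back : ∀ j m → j < m → suc j ≢ m → ∃ λ k → m ≡ j + suc (suc k)
    two-back j (suc m) (s≤s j≤m) j+1≢ with m≤n⇒m<n∨m≡n j≤m
    ... | inj₂ refl = ⊥-elim (j+1≢ refl)
    ... | inj₁ j<m with m | j<m
    ...   | suc m' | s≤s j≤m' = m' ∸ j , sym (begin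
      j + suc (suc (m' ∸ j))    ≡⟨ +-suc j _ ⟩
      suc (j + suc (m' ∸ j))    ≡⟨ cong suc (+-suc j _) ⟩
      suc (suc (j + (m' ∸ j)))  ≡⟨ cong (suc ∘ suc) (m+[n∸m]≡n j≤m') ⟩
      suc (suc m')              ∎)
      where open ≡-Reasoning

    module FirstRepeat (m : ℕ) (first : ∀ k → k < m → ¬ Repeat k) where

      U-distinct : ∀ a b → a < b → b < m → U a ≢ U b
      U-distinct a b a<b b<m eq = first b b<m (inj₁ (a , a<b , eq))

      C-distinct : ∀ a b → a < b → b < m → C a ≢ C b
      C-distinct a b a<b b<m eq = first b b<m (inj₂ (a , a<b , eq))

      -- U j = U m closes the cycle U j, C j, …, U (m-1), C (m-1)
      variable-repeat : ∀ j → j < m → U j ≡ U m → Cycle F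
      variable-repeat j j<m eq with two-back j m j<m (λ j+1≡m → U-turns j (trans (cong U j+1≡m) (sym eq)))
      ... | k , refl = closed-walk-cycle U C j k (λ a b _ a<b b≤ → U-distinct a b a<b (below b≤))
                                                 (λ a b _ a<b b≤ → C-distinct a b a<b (below b≤)) U∈C U'∈C closing
        where
        below : ∀ {b} → b ≤ j + suc k → b < j + suc (suc k)
        below {b} b≤ = subst (suc b ≤_) (sym (+-suc j (suc k))) (s≤s b≤)
        closing : U j ∈ clauseVars (C (j + suc k))
        closing = subst (_∈ clauseVars (C (j + suc k))) (sym (trans eq (cong U (+-suc j (suc k))))) (U'∈C (j + suc k))

      -- C j = C m with U m new closes the cycle U (j+1), C (j+1), …, U m, C m
      clause-repeat : ∀ j → j < m → C j ≡ C m → (∀ j → j < m → U j ≢ U m) → Cycle F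
      clause-repeat j j<m eq U-new with two-back j m j<m (λ j+1≡m → C-turns j (trans (cong C j+1≡m) (sym eq)))
      ... | k , refl = closed-walk-cycle U C (suc j) k U-dist C-dist U∈C U'∈C closing
        where
        top : suc j + suc k ≡ j + suc (suc k)
        top = sym (+-suc j (suc k))
        U-dist : DistinctOn U (suc j) (suc j + suc k)
        U-dist a b _ a<b b≤ with m≤n⇒m<n∨m≡n (subst (b ≤_) top b≤)
        ... | inj₁ b<m = U-distinct a b a<b b<m
        ... | inj₂ refl = U-new a a<b
        C-dist : DistinctOn C (suc j) (suc j + suc k)
        C-dist a b j<a a<b b≤ with m≤n⇒m<n∨m≡n (subst (b ≤_) top b≤)
        ... | inj₁ b<m = C-distinct a b a<b b<m
        ... | inj₂ refl = λ Ca≡Cm → C-distinct j a j<a a<b (trans eq (sym Ca≡Cm))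
        closing : U (suc j) ∈ clauseVars (C (suc j + suc k))
        closing = subst (λ c → U (suc j) ∈ clauseVars c) (trans eq (cong C (sym top))) (U'∈C j)

      repeat-cycle : Repeat m → Cycle F
      repeat-cycle (inj₁ (j , j<m , eq)) = variable-repeat j j<m eq
      repeat-cycle (inj₂ (j , j<m , eq)) with search-below (λ j → U j ≡ U m) (λ j → U j ℕ.≟ U m) m
      ... | inj₁ (j' , j'<m , eq') = variable-repeat j' j'<m eq'
      ... | inj₂ U-new = clause-repeat j j<m eq U-new

    cycle : Cycle F
    cycle with some-repeat
    ... | N , N≤n , rep-N with least Repeat repeat? n N N≤n rep-N
    ...   | m , rep , first = FirstRepeat.repeat-cycle m first rep

  leaf-or-all-branching : ∀ R S → (∃ λ c → (c ∈ S) × IsLeaf R c) ⊎ (∀ c → c ∈ S → Branching R c)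
  leaf-or-all-branching R [] = inj₂ λ _ ()
  leaf-or-all-branching R (c ∷ S) with leaf-or-branching R c | leaf-or-all-branching R S
  ... | inj₁ leaf | _ = inj₁ (c , here refl , leaf)
  ... | inj₂ _ | inj₁ (c' , c'∈ , leaf) = inj₁ (c' , there c'∈ , leaf)
  ... | inj₂ br | inj₂ brs = inj₂ λ { c' (here refl) → br ; c' (there c'∈) → brs c' c'∈ }

  leaf : Acyclic F → ∀ c₀ R → ∃ λ c → (c ∈ c₀ ∷ R) × IsLeaf (c₀ ∷ R) c
  leaf acyclic c₀ R with leaf-or-all-branching (c₀ ∷ R) (c₀ ∷ R)
  ... | inj₁ found = found
  ... | inj₂ all-branching = ⊥-elim (acyclic (Walk.cycle (c₀ ∷ R) all-branching c₀ (here refl)))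

  data LeafOrdered : List (Fin n) → Set where
    []  : LeafOrdered []
    _∷_ : ∀ {c L} → (c ∉ L) × (∃ λ w → ∀ u → u ∈ clauseVars c → ∀ j → j ∈ L → u ∈ clauseVars j → u ≡ w) →
          LeafOrdered L → LeafOrdered (c ∷ L)

  without : Fin n → List (Fin n) → List (Fin n)
  without c = filter (λ j → ¬? (j Fin.≟ c))

  peel : Acyclic F → ∀ k R → length R ≤ k →
    ∃ λ L → LeafOrdered L × (∀ c → c ∈ R → c ∈ L) × (∀ c → c ∈ L → c ∈ R)
  peel acyclic k [] _ = [] , [] , (λ _ ()) , (λ _ ())
  peel acyclic (suc k) (c₀ ∷ R) |R|≤ with leaf acyclic c₀ R
  ... | c , c∈R , w , c-leaf with peel acyclic k (without c (c₀ ∷ R)) (≤-pred (≤-trans shorter |R|≤))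
    where
    shorter : length (without c (c₀ ∷ R)) < length (c₀ ∷ R)
    shorter = filter-notAll (λ j → ¬? (j Fin.≟ c)) (c₀ ∷ R) (lose c∈R (λ c≢c → c≢c refl))
  ...   | L , ordered , R⊆L , L⊆R = c ∷ L , (c∉L , w , meets) ∷ ordered , covers , within
    where
    remaining : ∀ {j} → j ∈ L → (j ∈ c₀ ∷ R) × (j ≢ c)
    remaining j∈L = ∈-filter⁻ (λ j → ¬? (j Fin.≟ c)) (L⊆R _ j∈L)
    c∉L : c ∉ L
    c∉L c∈L = proj₂ (remaining c∈L) refl
    meets : ∀ u → u ∈ clauseVars c → ∀ j → j ∈ L → u ∈ clauseVars j → u ≡ w
    meets u u∈c j j∈L u∈j = let j∈R , j≢c = remaining j∈L in c-leaf u u∈c (lose j∈R (j≢c , u∈j))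
    covers : ∀ j → j ∈ c₀ ∷ R → j ∈ c ∷ L
    covers j j∈R with j Fin.≟ c
    ... | yes refl = here refl
    ... | no j≢c = there (R⊆L j (∈-filter⁺ (λ j → ¬? (j Fin.≟ c)) j∈R j≢c))
    within : ∀ j → j ∈ c ∷ L → j ∈ c₀ ∷ R
    within j (here refl) = c∈R
    within j (there j∈L) = proj₁ (remaining j∈L)

  leaf-order : Acyclic F → ∃ λ L → LeafOrdered L × (∀ c → c ∈ L)
  leaf-order acyclic with peel acyclic n (allFin n) (≤-reflexive (length-tabulate (λ c → c)))
  ... | L , ordered , covers , _ = L , ordered , (λ c → covers c (∈-allFin c))

module X₁ (F : ClauseSet) (wf : WellFormed F) (acyclic : Acyclic F) (y : ℕ → ℕ → ℕ) (fresh : Fresh F y) where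

  open LeafOrder F using (n; clauseVars; LeafOrdered; []; _∷_; leaf-order)

  X1F : ClauseSet
  X1F = X1 y F

  P : Fin n → ClauseSet
  P i = naturalSplit (y (toℕ i)) (lookup F i)

  y-inj : ∀ m j k → y m j ≡ y m k → j ≡ k
  y-inj m j k eq = proj₂ (proj₁ fresh m j m k eq)

  module Split (m : ℕ) = Splitting (y m) (y-inj m)

  clauseVars-⊆ : ∀ i u → u ∈ clauseVars i → u ∈ vars F
  clauseVars-⊆ i u u∈ = ∈-vars F (∈-lookup i) u∈

  y∉clause : ∀ i m j → y m j ∉ clauseVars i
  y∉clause i m j y∈ = proj₂ fresh m j (clauseVars-⊆ i (y m j) y∈)

  clause-unique : ∀ i → Unique (clauseVars i)
  clause-unique i = All.lookup (proj₁ wf) (∈-lookup i)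

  private
    shift : ∀ G {D} (i : Fin (length G)) {a b} → a ≡ b →
            D ∈ naturalSplit (y a) (lookup G i) → D ∈ naturalSplit (y b) (lookup G i)
    shift G {D} i eq = subst (λ a → D ∈ naturalSplit (y a) (lookup G i)) eq

  X1-from-∈⁻ : ∀ m G {C} → C ∈ X1-from m y G →
    ∃₂ λ (i : Fin (length G)) D → (D ∈ naturalSplit (y (toℕ i + m)) (lookup G i)) × (C ∈ X0 D)
  X1-from-∈⁻ m (C₀ ∷ G) C∈ with ∈-++⁻ (X1C (y m) C₀) C∈
  ... | inj₁ C∈here = let D , D∈ , C∈X0 = find (∈-concatMap⁻ X0 {xs = naturalSplit (y m) C₀} C∈here)
                      in fzero , D , D∈ , C∈X0
  ... | inj₂ C∈later with X1-from-∈⁻ (suc m) G C∈later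
  ...   | i , D , D∈ , C∈X0 = fsuc i , D , shift G i (+-suc (toℕ i) m) D∈ , C∈X0

  X1-from-∈⁺ : ∀ m G {C D} (i : Fin (length G)) → D ∈ naturalSplit (y (toℕ i + m)) (lookup G i) → C ∈ X0 D →
    C ∈ X1-from m y G
  X1-from-∈⁺ m (C₀ ∷ G) fzero D∈ C∈X0 = ∈-++⁺ˡ (∈-concatMap⁺ X0 (lose D∈ C∈X0))
  X1-from-∈⁺ m (C₀ ∷ G) (fsuc i) D∈ C∈X0 =
    ∈-++⁺ʳ (X1C (y m) C₀) (X1-from-∈⁺ (suc m) G i (shift G i (sym (+-suc (toℕ i) m)) D∈) C∈X0)

  X1-∈⁻ : ∀ {C} → C ∈ X1F → ∃₂ λ i D → (D ∈ P i) × (C ∈ X0 D)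
  X1-∈⁻ C∈ with X1-from-∈⁻ 0 F C∈
  ... | i , D , D∈ , C∈X0 = i , D , shift F i (+-identityʳ (toℕ i)) D∈ , C∈X0

  X1-∈⁺ : ∀ {C D} i → D ∈ P i → C ∈ X0 D → C ∈ X1F
  X1-∈⁺ i D∈ = X1-from-∈⁺ 0 F i (shift F i (sym (+-identityʳ (toℕ i))) D∈)

  pieces⇒X1 : ∀ γ → (∀ i → XSat γ (P i)) → SatBy γ X1F
  pieces⇒X1 γ pieces = All.tabulate λ C∈ →
    let i , D , D∈ , C∈X0 = X1-∈⁻ C∈ in All.lookup (X0-complete γ D (All.lookup (pieces i) D∈)) C∈X0

  X1⇒pieces : ∀ γ → SatBy γ X1F → ∀ i → XSat γ (P i)
  X1⇒pieces γ γX1 i = All.tabulate λ {D} D∈ → X0-sound γ D (All.tabulate λ C∈X0 → All.lookup γX1 (X1-∈⁺ i D∈ C∈X0))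

  -- every variable of F occurs in X₁(F): flip the sign of one literal of a piece containing it
  vars-⊆ : ∀ v → v ∈ vars F → v ∈ vars X1F
  vars-⊆ v v∈ with find (∈-concatMap⁻ varsC {xs = F} v∈)
  ... | C , C∈ , v∈C with find (∈-concatMap⁻ varsC {xs = P i} (Split.split-⊇ (toℕ i) (lookup F i) v v∈Cᵢ))
    where
    i = Any.index C∈
    v∈Cᵢ = subst (λ C → v ∈ varsC C) (lookup-index C∈) v∈C
  ...   | [] , _ , ()
  ...   | d ∷ D , D∈ , v∈D =
    ∈-vars X1F (X1-∈⁺ (Any.index C∈) D∈ (flip-head-∈-X0 d D)) (subst (v ∈_) (sym (flip-head-vars (d ∷ D))) v∈D)

  -- At a fixpoint of unit propagation everything can still be solved

  module Fixpoint (ρ : PAss) (no-empty : [] ∉ apply ρ X1F) (no-unit : ∀ l → [ l ] ∉ apply ρ X1F) where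

    -- a piece violated by some constant completion of ρ leaves a clause of
    -- ρ * X₁(F) over exactly its open variables (the reduct of its falsifier)
    violated-piece : ∀ i D → D ∈ P i → ∀ t → xorVal (complete ρ (λ _ → t)) D ≡ true →
      ∃ λ E → (E ∈ apply ρ X1F) × (varsC E ≡ openVars ρ D)
    violated-piece i D D∈ t violated = filterᵇ (unassigned ρ) E , reduct∈ , openVars-cong ρ E D (falsifier-vars γ D)
      where
      γ = complete ρ (λ _ → t)
      E = falsifier γ D
      reduct∈ : filterᵇ (unassigned ρ) E ∈ apply ρ X1F
      reduct∈ with applied ρ E
      ... | reduced eq _ = mapMaybe-∈⁺ (applyC ρ) X1F (X1-∈⁺ i D∈ (falsifier-∈-X0 γ D violated)) eq
      ... | satisfied _ (l , l∈ , ρl)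
            with trans (sym (plitVal-just ρ (λ _ → t) l true ρl)) (All.lookup (falsifier-false γ D) l∈)
      ...   | ()

    -- hence no piece is left with one open variable, or with none and violated
    flexible : ∀ i D → D ∈ P i → Flexible ρ D
    flexible i D D∈ with openVars ρ D in open-eq
    ... | p ∷ p' ∷ r = inj₁ (p , p' , r , refl)
    ... | [] with fixedPart ρ D in fixed
    ...   | false = inj₂ (refl , refl)
    ...   | true with violated-piece i D D∈ false fixed
    ...     | [] , E∈ , _ = ⊥-elim (no-empty E∈)
    ...     | _ ∷ _ , _ , E-vars with trans E-vars open-eq
    ...       | ()
    flexible i D D∈ | p ∷ [] with violated-piece i D D∈ (not (fixedPart ρ D)) violated
      where
      violated : xorVal (complete ρ (λ _ → not (fixedPart ρ D))) D ≡ true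
      violated rewrite xorVal-split ρ (λ _ → not (fixedPart ρ D)) D | open-eq
                     | xor-identityʳ (not (fixedPart ρ D)) = xor-inverseʳ (fixedPart ρ D)
    ... | l ∷ [] , E∈ , _ = ⊥-elim (no-unit l E∈)
    ... | [] , _ , E-vars with trans E-vars open-eq
    ...   | ()
    flexible i D D∈ | p ∷ [] | _ ∷ _ ∷ _ , _ , E-vars with trans E-vars open-eq
    ...   | ()

    piece-solvable : ∀ i D → D ∈ P i → Solvable1 ρ D
    piece-solvable i D D∈ = flexible-solvable ρ D (openVars-unique ρ D D-unique) (flexible i D D∈)
      where
      D-unique = All.lookup (Split.split-pieces-unique (toℕ i) (lookup F i) (clause-unique i) (y∉clause i (toℕ i))) D∈

    block-solvable : ∀ i → Solvable ρ (P i)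
    block-solvable i = linear-solvable ρ (P i)
      (Split.split-linear (toℕ i) (lookup F i) (clause-unique i) (y∉clause i (toℕ i))) (piece-solvable i)

    -- the blocks in leaf order form a forest: the new variables of distinct
    -- clauses are distinct, so blocks meet only in variables of F
    forest : ∀ L → LeafOrdered L → Forest ρ (map P L)
    forest [] [] = []
    forest (i ∷ L) ((i∉L , w , meets) ∷ ordered) = ((w , meet) , block-solvable i) ∷ forest L ordered
      where
      meet : ∀ u → u ∈ vars (P i) → u ∈ vars (concat (map P L)) → u ≡ w
      meet u u∈i u∈L with find (∈-concatMap⁻ varsC {xs = concat (map P L)} u∈L)
      ... | D , D∈ , u∈D with ∈-concat⁻′ (map P L) D∈
      ...   | _ , D∈P , P∈ with ∈-map⁻ P P∈
      ...     | j , j∈L , refl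
                with Split.split-vars (toℕ i) (lookup F i) u u∈i | Split.split-vars (toℕ j) (lookup F j) u (∈-vars (P j) D∈P u∈D)
      ...       | inj₁ u∈Cᵢ | inj₁ u∈Cⱼ = meets u u∈Cᵢ j j∈L u∈Cⱼ
      ...       | inj₁ u∈Cᵢ | inj₂ (b , refl) = ⊥-elim (y∉clause i (toℕ j) b u∈Cᵢ)
      ...       | inj₂ (a , refl) | inj₁ u∈Cⱼ = ⊥-elim (y∉clause j (toℕ i) a u∈Cⱼ)
      ...       | inj₂ (a , refl) | inj₂ (b , eq) with Fin.toℕ-injective (proj₁ (proj₁ fresh (toℕ i) a (toℕ j) b eq))
      ...         | refl = ⊥-elim (i∉L j∈L)

    solve-fixpoint : ∀ v b → ∃ λ β → (∀ i → XSat (complete ρ β) (P i)) × (β v ≡ b)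
    solve-fixpoint v b with leaf-order acyclic
    ... | L , ordered , covers with forest-solvable ρ (map P L) (forest L ordered) v b
    ...   | β , sol , βv = β , (λ i → All.tabulate λ D∈ → All.lookup sol (∈-concat⁺′ D∈ (∈-map⁺ P (covers i)))) , βv

    fixpoint-sat : ∀ β → (∀ i → XSat (complete ρ β) (P i)) → SatBy β (apply ρ X1F)
    fixpoint-sat β pieces = sat-apply ρ β (complete ρ β) X1F (λ _ → refl) (pieces⇒X1 (complete ρ β) pieces)

    -- above a total assignment of var(F), ρ also fixes all new variables,
    -- since two solutions agreeing on a clause agree on its splitting
    all-assigned : (∀ u → u ∈ vars F → ∃ λ b → ρ u ≡ just b) → ∀ i u → u ∈ vars (P i) → ρ u ≢ nothing
    all-assigned total i u u∈ unassigned-u with solve-fixpoint u false | solve-fixpoint u true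
    ... | β₀ , sol₀ , β₀u | β₁ , sol₁ , β₁u with
      Split.split-determined (toℕ i) (complete ρ β₀) (complete ρ β₁) (lookup F i) (sol₀ i) (sol₁ i) on-clause u u∈
      where
      on-clause : ∀ u → u ∈ clauseVars i → complete ρ β₀ u ≡ complete ρ β₁ u
      on-clause u u∈ with total u (clauseVars-⊆ i u u∈)
      ... | b , ρu rewrite ρu = refl
    ... | same rewrite unassigned-u | β₀u | β₁u with same
    ...   | ()

  splitting-solution : TAss → ℕ → ClauseSet → TAss
  splitting-solution γ m [] = γ
  splitting-solution γ m (C ∷ G) = splitting-solution (Split.split-solution m γ C) (suc m) G

  splitting-solution-off : ∀ γ m G u → (∀ a j → m ≤ a → u ≢ y a j) → splitting-solution γ m G u ≡ γ u
  splitting-solution-off γ m [] u _ = refl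
  splitting-solution-off γ m (C ∷ G) u not-y =
    trans (splitting-solution-off _ (suc m) G u (λ a j m<a → not-y a j (≤-trans (n≤1+n m) m<a)))
          (Split.split-solution-off m γ C u (λ j → not-y m j ≤-refl))

  splitting-solution-sat : ∀ γ m G → XSat γ G → All ProperClause G → (∀ a j → y a j ∉ vars G) →
    ∀ (i : Fin (length G)) → XSat (splitting-solution γ m G) (naturalSplit (y (toℕ i + m)) (lookup G i))
  splitting-solution-sat γ m (C ∷ G) (γC ∷ γG) (uniq ∷ _) y∉ fzero =
    All.tabulate λ {D} D∈ → trans (xorVal-cong _ _ D (λ u u∈ → later-keep u (∈-vars (naturalSplit (y m) C) D∈ u∈)))
                                  (All.lookup (Split.split-solution-sat m γ C uniq (λ j y∈ → y∉ m j (∈-++⁺ˡ y∈)) γC) D∈)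
    where
    γ₁ = Split.split-solution m γ C
    later-keep : ∀ u → u ∈ vars (naturalSplit (y m) C) → splitting-solution γ₁ (suc m) G u ≡ γ₁ u
    later-keep u u∈ = splitting-solution-off γ₁ (suc m) G u not-later
      where
      not-later : ∀ a j → suc m ≤ a → u ≢ y a j
      not-later a j m<a u≡yaj with Split.split-vars m C u u∈
      ... | inj₁ u∈C = y∉ a j (∈-++⁺ˡ (subst (_∈ varsC C) u≡yaj u∈C))
      ... | inj₂ (b , u≡ymb) with proj₁ (proj₁ fresh m b a j (trans (sym u≡ymb) u≡yaj))
      ...   | refl = <-irrefl refl m<a
  splitting-solution-sat γ m (C ∷ G) (γC ∷ γG) (_ ∷ proper) y∉ (fsuc i) =
    subst (λ a → XSat (splitting-solution γ₁ (suc m) G) (naturalSplit (y a) (lookup G i))) (+-suc (toℕ i) m)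
          (splitting-solution-sat γ₁ (suc m) G γ₁G proper (λ a j y∈ → y∉ a j (∈-++⁺ʳ (varsC C) y∈)) i)
    where
    γ₁ = Split.split-solution m γ C
    γ₁G : XSat γ₁ G
    γ₁G = All.tabulate λ {C'} C'∈ →
      trans (xorVal-cong γ₁ γ C' (λ u u∈ → Split.split-solution-off m γ C u
               (λ j u≡ → y∉ m j (∈-++⁺ʳ (varsC C) (subst (_∈ vars G) u≡ (∈-vars G C'∈ u∈))))))
            (All.lookup γG C'∈)

  representation : CNFRep F X1F
  representation = vars-⊆ , λ φ total → sound φ total , complete-rep φ total
    where
    on-F : ∀ φ → TotalOn φ (vars F) → ∀ β u → u ∈ vars F → complete φ β u ≡ toTAss φ u
    on-F φ total β u u∈ with proj₁ total u u∈
    ... | b , φu rewrite φu = refl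
    sound : ∀ φ → TotalOn φ (vars F) → Sat (apply φ X1F) → XSat (toTAss φ) F
    sound φ total (β , βX1) = All.tabulate λ {C} C∈ →
      let i = Any.index C∈ in
      subst (λ C → xorVal (toTAss φ) C ≡ false) (sym (lookup-index C∈))
        (trans (sym (xorVal-cong _ _ (lookup F i) (λ u u∈ → on-F φ total β u (clauseVars-⊆ i u u∈))))
               (Split.split-sound (toℕ i) (complete φ β) (lookup F i)
                  (X1⇒pieces (complete φ β) (apply-sat φ β X1F βX1) i)))
    complete-rep : ∀ φ → TotalOn φ (vars F) → XSat (toTAss φ) F → Sat (apply φ X1F)
    complete-rep φ total holds = γ , sat-apply φ γ γ X1F agree (pieces⇒X1 γ pieces)
      where
      γ = splitting-solution (toTAss φ) 0 F
      pieces : ∀ i → XSat γ (P i)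
      pieces i = subst (λ a → XSat γ (naturalSplit (y a) (lookup F i))) (+-identityʳ (toℕ i))
                       (splitting-solution-sat (toTAss φ) 0 F holds (proj₁ wf) (proj₂ fresh) i)
      agree : ∀ v → complete φ γ v ≡ γ v
      agree v with φ v in φv
      ... | nothing = refl
      ... | just b = sym (trans (splitting-solution-off (toTAss φ) 0 F v
                                   (λ a j _ v≡ → proj₂ fresh a j (subst (_∈ vars F) v≡ (proj₂ total v b φv))))
                                (cong (fromMaybe false) φv))

  propagation-complete : ∀ φ → (¬ Sat (apply φ X1F) → IsBotSet (r1 (apply φ X1F))) ×
                               (Sat (apply φ X1F) → ∀ x → ¬ Forced x (r1 (apply φ X1F)))
  propagation-complete φ with r1-result X1F φ
  ... | r1-bot eq unsat = (λ _ → subst IsBotSet (sym eq) ((λ ()) , refl ∷ [])) , (λ sat → ⊥-elim (unsat sat))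
  ... | r1-fixed ρ ext eq no-empty no-unit = refute , unforced
    where
    open Fixpoint ρ no-empty no-unit
    refute : ¬ Sat (apply φ X1F) → IsBotSet (r1 (apply φ X1F))
    refute unsat with solve-fixpoint 0 false
    ... | β , sol , _ = ⊥-elim (unsat (complete ρ β ,
            sat-apply φ (complete ρ β) (complete ρ β) X1F (complete-⊑ φ ρ β ext) (pieces⇒X1 (complete ρ β) sol)))
    unforced : Sat (apply φ X1F) → ∀ x → ¬ Forced x (r1 (apply φ X1F))
    unforced _ x forced with solve-fixpoint (var x) (isNeg x)
    ... | β , sol , βx = forced (subst (λ G → Sat (apply (single x false) G)) (sym eq)
            (β , sat-apply (single x false) β β (apply ρ X1F) (complete-single x false β (litVal-false β x βx))
                           (fixpoint-sat β sol)))

  propagation-total : ∀ φ → TotalOn φ (vars F) → Sat (apply φ X1F) → r1 (apply φ X1F) ≡ []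
  propagation-total φ total sat with r1-result X1F φ
  ... | r1-bot _ unsat = ⊥-elim (unsat sat)
  ... | r1-fixed ρ ext eq no-empty no-unit = trans eq (no-clause (apply ρ X1F) refl)
    where
    open Fixpoint ρ no-empty no-unit
    ρ-total : ∀ u → u ∈ vars F → ∃ λ b → ρ u ≡ just b
    ρ-total u u∈ = let b , φu = proj₁ total u u∈ in b , ext u b φu
    -- every clause of ρ * X₁(F) would contain an open variable of a piece
    no-clause : ∀ G → G ≡ apply ρ X1F → G ≡ []
    no-clause [] _ = refl
    no-clause (E ∷ _) G≡ with mapMaybe-∈⁻ (applyC ρ) X1F (subst (E ∈_) G≡ (here refl))
    ... | C₀ , C₀∈ , applied-C₀ with applied ρ C₀
    ...   | satisfied eq' _ with trans (sym eq') applied-C₀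
    ...     | ()
    no-clause (E ∷ _) G≡ | C₀ , C₀∈ , applied-C₀ | reduced eq' _ with trans (sym eq') applied-C₀
    ...     | refl with filterᵇ (unassigned ρ) C₀ in reduct | subst (_ ∈_) G≡ (here refl)
    ...       | [] | E∈ = ⊥-elim (no-empty (subst (_∈ apply ρ X1F) reduct E∈))
    ...       | l ∷ _ | _ with filterᵇ-∈⁻ (unassigned ρ) C₀ (subst (l ∈_) (sym reduct) (here refl)) | X1-∈⁻ C₀∈
    ...         | l∈C₀ , l-open | i , D , D∈ , C₀∈X0 =
      ⊥-elim (all-assigned ρ-total i (var l)
        (∈-vars (P i) D∈ (subst (var l ∈_) (proj₁ (X0-∈⁻ C₀ D C₀∈X0)) (∈-map⁺ var l∈C₀)))
        (plitVal-nothing-var ρ l (isUnassigned-nothing _ l-open)))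

theorem9p7 : (F : ClauseSet) → WellFormed F → Acyclic F →
    (y : ℕ → ℕ → ℕ) → Fresh F y → AbsForcing F (X1 y F)
theorem9p7 F wf acyclic y fresh = (representation , phd≤1 , propagation-total) , pc
  where
  open X₁ F wf acyclic y fresh
  phd≤1 : Phd≤1 (vars F) (X1 y F)
  phd≤1 φ _ = let refute , unforced = propagation-complete φ in refute , λ sat x _ → unforced sat x
  pc : PC (X1 y F)
  pc φ _ = let refute , unforced = propagation-complete φ in refute , λ sat x _ → unforced sat x
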